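{- Let $G=C_3\oplus C_3\oplus C_3$ and $U\in\mathcal F(G)$. The following are equivalent: (a) $U\in\mathcal A(G)$ and $|U|=\mathsf D(G)$. (b) There exist a basis $(e_1,e_2,e_3)$ of $G$ and $a_i,b_j\in[0,2]$ for $i\in[1,5]$, $j\in[1,3]$, with $\sum_{i=1}^5a_i\equiv\sum_{j=1}^3b_j\equiv1\pmod 3$, such that $$U=e_1^2\prod_{i=1}^2(a_ie_1+e_2)\prod_{j=1}^3(a_{2+j}e_1+b_je_2+e_3).$$ In particular, $\mathsf h(U)=2$ for every $U\in\mathcal A(G)$ with $|U|=\mathsf D(G)$.
   Context: $\mathcal F(G)$ is the free abelian monoid on $G$ (sequences, written multiplicatively), $|U|$ the length, $\mathsf v_g(U)$ the multiplicity of $g$ in $U$, and $\mathsf h(U)=\max_{g\in G}\mathsf v_g(U)$. $\mathcal A(G)$ is the set of minimal zero-sum sequences over $G$ (nonempty sequences with term sum $0$ and no proper nonempty zero-sum subsequence), and $\mathsf D(G)$ is the maximal length of an element of $\mathcal A(G)$. A basis of $G$ is an independent generating family of nonzero elements. -}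

module Defs where

open import Data.Nat using (ℕ; zero; suc; _+_; _*_; _⊔_; _≤_)
open import Data.Nat.DivMod using (_mod_; _%_)
open import Data.Fin using (Fin; toℕ)
open import Data.Fin.Properties as FinP using ()
open import Data.Product using (_×_; _,_; ∃; ∃-syntax; Σ-syntax)
open import Data.Product.Properties using (≡-dec)
open import Data.List using (List; []; _∷_; _++_; length; map; foldr; cartesianProduct)
open import Data.List.Relation.Binary.Permutation.Propositional using (_↭_)
open import Relation.Binary.PropositionalEquality using (_≡_)
open import Relation.Nullary using (¬_; yes; no)
open import Relation.Binary.Definitions using (DecidableEquality)

import Data.List

Z3 : Set
Z3 = Fin 3

_+₃_ : Z3 → Z3 → Z3
a +₃ b = (toℕ a + toℕ b) mod 3

_·₃_ : ℕ → Z3 → Z3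
n ·₃ a = (n * toℕ a) mod 3

G : Set
G = Z3 × Z3 × Z3

0G : G
0G = (0 mod 3 , 0 mod 3 , 0 mod 3)

_⊕_ : G → G → G
(x₁ , x₂ , x₃) ⊕ (y₁ , y₂ , y₃) = (x₁ +₃ y₁ , x₂ +₃ y₂ , x₃ +₃ y₃)
infixl 6 _⊕_

_·_ : ℕ → G → G
n · (x₁ , x₂ , x₃) = (n ·₃ x₁ , n ·₃ x₂ , n ·₃ x₃)
infixl 7 _·_

_≟G_ : DecidableEquality G
_≟G_ = ≡-dec FinP._≟_ (≡-dec FinP._≟_ FinP._≟_)

allG : List G
allG = cartesianProduct (Data.List.allFin 3)
         (cartesianProduct (Data.List.allFin 3) (Data.List.allFin 3))

-- Sequences over G: elements of the free abelian monoid F(G),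
-- represented by lists, considered up to permutation (_↭_).
Seq : Set
Seq = List G

σ : Seq → G
σ = foldr _⊕_ 0G

v : G → Seq → ℕ
v g [] = 0
v g (x ∷ U) with g ≟G x
... | yes _ = suc (v g U)
... | no  _ = v g U

h : Seq → ℕ
h U = foldr _⊔_ 0 (map (λ g → v g U) allG)

-- U ∈ A(G): nonempty, zero-sum, and no proper nonempty zero-sum subsequence.
-- V is a subsequence of U iff U = V·W in F(G), i.e. U ↭ V ++ W;
-- V is proper iff W is nonempty.
IsAtom : Seq → Set
IsAtom U = ¬ (U ≡ []) × σ U ≡ 0G ×
  (∀ (V W : Seq) → U ↭ V ++ W → ¬ (V ≡ []) → ¬ (W ≡ []) → ¬ (σ V ≡ 0G))

IsDavenport : ℕ → Set
IsDavenport d = (∃[ U ] (IsAtom U × length U ≡ d)) × (∀ U → IsAtom U → length U ≤ d)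

IsBasis : G → G → G → Set
IsBasis e₁ e₂ e₃ =
  (¬ (e₁ ≡ 0G) × ¬ (e₂ ≡ 0G) × ¬ (e₃ ≡ 0G)) ×
  (∀ (m₁ m₂ m₃ : ℕ) → m₁ · e₁ ⊕ m₂ · e₂ ⊕ m₃ · e₃ ≡ 0G →
      (m₁ · e₁ ≡ 0G) × (m₂ · e₂ ≡ 0G) × (m₃ · e₃ ≡ 0G)) ×
  (∀ (g : G) → ∃[ m₁ ] ∃[ m₂ ] ∃[ m₃ ] (g ≡ m₁ · e₁ ⊕ m₂ · e₂ ⊕ m₃ · e₃))

CondB : Seq → Set
CondB U =
  ∃[ e₁ ] ∃[ e₂ ] ∃[ e₃ ] (IsBasis e₁ e₂ e₃ ×
  ∃[ a₁ ] ∃[ a₂ ] ∃[ a₃ ] ∃[ a₄ ] ∃[ a₅ ] ∃[ b₁ ] ∃[ b₂ ] ∃[ b₃ ]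
   ((a₁ ≤ 2 × a₂ ≤ 2 × a₃ ≤ 2 × a₄ ≤ 2 × a₅ ≤ 2 × b₁ ≤ 2 × b₂ ≤ 2 × b₃ ≤ 2) ×
    (a₁ + a₂ + a₃ + a₄ + a₅) % 3 ≡ 1 ×
    (b₁ + b₂ + b₃) % 3 ≡ 1 ×
    U ↭ (e₁ ∷ e₁ ∷
         (a₁ · e₁ ⊕ e₂) ∷ (a₂ · e₁ ⊕ e₂) ∷
         (a₃ · e₁ ⊕ b₁ · e₂ ⊕ e₃) ∷
         (a₄ · e₁ ⊕ b₂ · e₂ ⊕ e₃) ∷
         (a₅ · e₁ ⊕ b₃ · e₂ ⊕ e₃) ∷ [])))

module Submission where

-- G is a 3-dimensional vector space over C₃, so everything is decided by finite computation,
-- each computation being justified by a soundness lemma.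
-- Normalising, every zero-sum free sequence of length 6 + k becomes e1·e2·e3·R up to an
-- automorphism.  The search shows that no such R of length 4 exists (so D(G) ≤ 7), and lists
-- the finitely many R of length 3; each completion of e1·e2·e3·R to an atom comes with a checked
-- certificate for (b) and h = 2.  Conversely (b) is checked for the standard basis and all
-- parameters, and transported to any basis.

open import Defs
open import Data.Nat using (ℕ; zero; suc; _+_; _*_; _%_; _<_; _≤_; _≤?_; _≤ᵇ_; _≟_; _⊔_; _⊓_; s≤s; z≤n)
import Data.Nat.Properties as ℕP
open import Data.Nat.DivMod using (_mod_; m%n<n; %-distribˡ-*; m%n%n≡m%n)
open import Data.Fin using (toℕ) renaming (zero to fz; suc to fs)
import Data.Fin.Properties as FinP
open import Data.Bool using (Bool; true; false; T; _∧_; _∨_; not; if_then_else_)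
open import Data.Bool.Properties using (T-∧; T-∨)
open import Data.Empty using (⊥-elim)
open import Data.Product using (_×_; _,_; proj₁; proj₂; Σ-syntax; ∃-syntax; uncurry)
open import Data.Sum using (_⊎_; inj₁; inj₂)
open import Data.Maybe using (Maybe; just; nothing; is-just; to-witness-T; _<∣>_)
import Data.Maybe as Maybe
open import Data.List using (List; []; _∷_; _++_; [_]; map; foldr; length; concatMap; take; drop)
open import Data.List.Properties using (++-assoc; map-++; map-∘; length-map; length-take; take++drop≡id)
open import Data.List.Membership.Propositional using (_∈_; _∉_; lose; find)
open import Data.List.Membership.Propositional.Properties
  using (∉[]; ∈-map⁺; ∈-map⁻; ∈-++⁺ˡ; ∈-++⁺ʳ; ∈-++⁻; ∈-∃++; ∈-cartesianProduct⁺; ∈-allFin; ∈-concatMap⁺)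
open import Data.List.Membership.DecPropositional _≟G_ using (_∈?_)
open import Data.List.Relation.Unary.Any as Any using (Any; here; there)
open import Data.List.Relation.Unary.All as All using (All; []; _∷_)
open import Data.List.Relation.Unary.All.Properties using (++⁻ˡ; ¬All⇒Any¬)
open import Data.List.Relation.Unary.Linked using (Linked; [-]; _∷_)
open import Data.List.Relation.Binary.Permutation.Propositional
  using (_↭_; refl; prep; swap; ↭-sym; ↭-refl; ↭-reflexive) renaming (trans to ↭-trans)
open import Data.List.Relation.Binary.Permutation.Propositional.Properties
  using (shift; shifts; drop-∷; ∈-resp-↭; ↭-empty-inv; ↭-length; ++-comm; ++⁺ˡ; ++⁺ʳ; map⁺; All-resp-↭)
open import Data.Vec using (Vec; []; _∷_)
import Data.Vec.Relation.Unary.All as VecAll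
open VecAll using ([]; _∷_)
open import Function using (_∘_)
open import Function.Bundles using (Equivalence; _⇔_; mk⇔)
open import Relation.Nullary using (¬_; Dec; yes; no; isYes; _because_; ¬?; _×-dec_; _→-dec_)
open import Relation.Nullary.Reflects using (invert)
open import Relation.Nullary.Decidable using (map′; toWitness; fromWitness; T?)
import Relation.Binary.Construct.On as On
open import Relation.Binary.PropositionalEquality
  using (_≡_; refl; sym; trans; cong; cong₂; subst; subst₂; module ≡-Reasoning)

pattern F0 = fz
pattern F1 = fs fz
pattern F2 = fs (fs fz)

+₃-comm : ∀ a b → a +₃ b ≡ b +₃ a
+₃-comm = toWitness {a? = FinP.all? λ a → FinP.all? λ b → a +₃ b FinP.≟ b +₃ a} _

+₃-assoc : ∀ a b c → (a +₃ b) +₃ c ≡ a +₃ (b +₃ c)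
+₃-assoc = toWitness {a? = FinP.all? λ a → FinP.all? λ b → FinP.all? λ c →
  (a +₃ b) +₃ c FinP.≟ a +₃ (b +₃ c)} _

+₃-identityˡ : ∀ a → F0 +₃ a ≡ a
+₃-identityˡ = toWitness {a? = FinP.all? λ a → F0 +₃ a FinP.≟ a} _

+₃-identityʳ : ∀ a → a +₃ F0 ≡ a
+₃-identityʳ = toWitness {a? = FinP.all? λ a → a +₃ F0 FinP.≟ a} _

+₃-inverse : ∀ a → a +₃ (2 ·₃ a) ≡ F0
+₃-inverse = toWitness {a? = FinP.all? λ a → a +₃ (2 ·₃ a) FinP.≟ F0} _

·₃-distrib : ∀ a b c → toℕ (a +₃ b) ·₃ c ≡ (toℕ a ·₃ c) +₃ (toℕ b ·₃ c)
·₃-distrib = toWitness {a? = FinP.all? λ a → FinP.all? λ b → FinP.all? λ c →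
  toℕ (a +₃ b) ·₃ c FinP.≟ (toℕ a ·₃ c) +₃ (toℕ b ·₃ c)} _

·₃-zero : ∀ a → 0 ·₃ a ≡ F0
·₃-zero = toWitness {a? = FinP.all? λ a → 0 ·₃ a FinP.≟ F0} _

·₃-one : ∀ a → 1 ·₃ a ≡ a
·₃-one = toWitness {a? = FinP.all? λ a → 1 ·₃ a FinP.≟ a} _

·₃-two : ∀ a → 2 ·₃ a ≡ a +₃ a
·₃-two = toWitness {a? = FinP.all? λ a → 2 ·₃ a FinP.≟ a +₃ a} _

·₃-two-zero : ∀ a → 2 ·₃ a ≡ F0 → a ≡ F0
·₃-two-zero = toWitness {a? = FinP.all? λ a → (2 ·₃ a FinP.≟ F0) →-dec (a FinP.≟ F0)} _

·₃-mod : ∀ n a → n ·₃ a ≡ (n % 3) ·₃ a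
·₃-mod n a = FinP.toℕ-injective (begin
  toℕ (n ·₃ a)                         ≡⟨ FinP.toℕ-fromℕ< _ ⟩
  (n * toℕ a) % 3                      ≡⟨ %-distribˡ-* n (toℕ a) 3 ⟩
  ((n % 3) * (toℕ a % 3)) % 3          ≡⟨ cong (λ m → (m * (toℕ a % 3)) % 3) (sym (m%n%n≡m%n n 3)) ⟩
  ((n % 3 % 3) * (toℕ a % 3)) % 3      ≡⟨ sym (%-distribˡ-* (n % 3) (toℕ a) 3) ⟩
  ((n % 3) * toℕ a) % 3                ≡⟨ sym (FinP.toℕ-fromℕ< _) ⟩
  toℕ ((n % 3) ·₃ a)                   ∎)
  where open ≡-Reasoning

triple-≡ : ∀ {a a' b b' c c' : Z3} → a ≡ a' → b ≡ b' → c ≡ c' → _≡_ {A = G} (a , b , c) (a' , b' , c')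
triple-≡ refl refl refl = refl

⊕-comm : ∀ x y → x ⊕ y ≡ y ⊕ x
⊕-comm (a , b , c) (a' , b' , c') = triple-≡ (+₃-comm a a') (+₃-comm b b') (+₃-comm c c')

⊕-assoc : ∀ x y z → (x ⊕ y) ⊕ z ≡ x ⊕ (y ⊕ z)
⊕-assoc (a , b , c) (a' , b' , c') (a'' , b'' , c'') =
  triple-≡ (+₃-assoc a a' a'') (+₃-assoc b b' b'') (+₃-assoc c c' c'')

⊕-identityˡ : ∀ x → 0G ⊕ x ≡ x
⊕-identityˡ (a , b , c) = triple-≡ (+₃-identityˡ a) (+₃-identityˡ b) (+₃-identityˡ c)

⊕-identityʳ : ∀ x → x ⊕ 0G ≡ x
⊕-identityʳ (a , b , c) = triple-≡ (+₃-identityʳ a) (+₃-identityʳ b) (+₃-identityʳ c)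

⊕-inverse : ∀ x → x ⊕ 2 · x ≡ 0G
⊕-inverse (a , b , c) = triple-≡ (+₃-inverse a) (+₃-inverse b) (+₃-inverse c)

·-distrib : ∀ a b x → toℕ (a +₃ b) · x ≡ toℕ a · x ⊕ toℕ b · x
·-distrib a b (x , y , z) = triple-≡ (·₃-distrib a b x) (·₃-distrib a b y) (·₃-distrib a b z)

·-zero : ∀ x → 0 · x ≡ 0G
·-zero (a , b , c) = triple-≡ (·₃-zero a) (·₃-zero b) (·₃-zero c)

·-one : ∀ x → 1 · x ≡ x
·-one (a , b , c) = triple-≡ (·₃-one a) (·₃-one b) (·₃-one c)

·-two : ∀ x → 2 · x ≡ x ⊕ x
·-two (a , b , c) = triple-≡ (·₃-two a) (·₃-two b) (·₃-two c)

·-two-zero : ∀ x → 2 · x ≡ 0G → x ≡ 0G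
·-two-zero (a , b , c) eq = triple-≡ (·₃-two-zero a (cong proj₁ eq))
  (·₃-two-zero b (cong (proj₁ ∘ proj₂) eq)) (·₃-two-zero c (cong (proj₂ ∘ proj₂) eq))

·-mod : ∀ n x → n · x ≡ (n % 3) · x
·-mod n (a , b , c) = triple-≡ (·₃-mod n a) (·₃-mod n b) (·₃-mod n c)

⊕-interchange : ∀ a b c d → (a ⊕ b) ⊕ (c ⊕ d) ≡ (a ⊕ c) ⊕ (b ⊕ d)
⊕-interchange a b c d = begin
  (a ⊕ b) ⊕ (c ⊕ d) ≡⟨ ⊕-assoc a b (c ⊕ d) ⟩
  a ⊕ (b ⊕ (c ⊕ d)) ≡⟨ cong (a ⊕_) (sym (⊕-assoc b c d)) ⟩
  a ⊕ ((b ⊕ c) ⊕ d) ≡⟨ cong (λ z → a ⊕ (z ⊕ d)) (⊕-comm b c) ⟩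
  a ⊕ ((c ⊕ b) ⊕ d) ≡⟨ cong (a ⊕_) (⊕-assoc c b d) ⟩
  a ⊕ (c ⊕ (b ⊕ d)) ≡⟨ sym (⊕-assoc a c (b ⊕ d)) ⟩
  (a ⊕ c) ⊕ (b ⊕ d) ∎
  where open ≡-Reasoning

⊕-inverse-unique : ∀ a b → a ⊕ b ≡ 0G → a ≡ 2 · b
⊕-inverse-unique a b eq = begin
  a                ≡⟨ sym (⊕-identityʳ a) ⟩
  a ⊕ 0G           ≡⟨ cong (a ⊕_) (sym (⊕-inverse b)) ⟩
  a ⊕ (b ⊕ 2 · b)  ≡⟨ sym (⊕-assoc a b (2 · b)) ⟩
  (a ⊕ b) ⊕ 2 · b  ≡⟨ cong (_⊕ 2 · b) eq ⟩
  0G ⊕ 2 · b       ≡⟨ ⊕-identityˡ (2 · b) ⟩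
  2 · b            ∎
  where open ≡-Reasoning

-- Additive maps G → G (group endomorphisms); they are automatically ℤ-linear.
-- A record, so that f can be inferred from a proof of Additive f.
record Additive (f : G → G) : Set where
  constructor additive
  field ⊕-homo : ∀ x y → f (x ⊕ y) ≡ f x ⊕ f y
open Additive

module _ {f : G → G} (f-additive : Additive f) where

  additive-zero : f 0G ≡ 0G
  additive-zero = begin
    f 0G                        ≡⟨ sym (⊕-identityʳ (f 0G)) ⟩
    f 0G ⊕ 0G                   ≡⟨ cong (f 0G ⊕_) (sym (⊕-inverse (f 0G))) ⟩
    f 0G ⊕ (f 0G ⊕ 2 · f 0G)    ≡⟨ sym (⊕-assoc (f 0G) (f 0G) (2 · f 0G)) ⟩
    (f 0G ⊕ f 0G) ⊕ 2 · f 0G    ≡⟨ cong (_⊕ 2 · f 0G) (sym (⊕-homo f-additive 0G 0G)) ⟩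
    f 0G ⊕ 2 · f 0G             ≡⟨ ⊕-inverse (f 0G) ⟩
    0G                          ∎
    where open ≡-Reasoning

  additive-·-small : ∀ k x → k < 3 → f (k · x) ≡ k · f x
  additive-·-small 0 x _ = trans (cong f (·-zero x)) (trans additive-zero (sym (·-zero (f x))))
  additive-·-small 1 x _ = trans (cong f (·-one x)) (sym (·-one (f x)))
  additive-·-small 2 x _ = trans (cong f (·-two x)) (trans (⊕-homo f-additive x x) (sym (·-two (f x))))
  additive-·-small (suc (suc (suc k))) x (s≤s (s≤s (s≤s ())))

  additive-· : ∀ n x → f (n · x) ≡ n · f x
  additive-· n x = begin
    f (n · x)        ≡⟨ cong f (·-mod n x) ⟩
    f (n % 3 · x)    ≡⟨ additive-·-small (n % 3) x (m%n<n n 3) ⟩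
    n % 3 · f x      ≡⟨ sym (·-mod n (f x)) ⟩
    n · f x          ∎
    where open ≡-Reasoning

  additive-combination : ∀ m₁ m₂ m₃ e₁ e₂ e₃ →
    f (m₁ · e₁ ⊕ m₂ · e₂ ⊕ m₃ · e₃) ≡ m₁ · f e₁ ⊕ m₂ · f e₂ ⊕ m₃ · f e₃
  additive-combination m₁ m₂ m₃ e₁ e₂ e₃ = trans (⊕-homo f-additive _ _)
    (cong₂ _⊕_ (trans (⊕-homo f-additive _ _) (cong₂ _⊕_ (additive-· m₁ e₁) (additive-· m₂ e₂)))
               (additive-· m₃ e₃))

e1 e2 e3 : G
e1 = (F1 , F0 , F0)
e2 = (F0 , F1 , F0)
e3 = (F0 , F0 , F1)

lin : G → G → G → G → G
lin p q r (x₁ , x₂ , x₃) = toℕ x₁ · p ⊕ toℕ x₂ · q ⊕ toℕ x₃ · r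

lin-additive : ∀ p q r → Additive (lin p q r)
lin-additive p q r = additive homo
  where
  homo : ∀ x y → lin p q r (x ⊕ y) ≡ lin p q r x ⊕ lin p q r y
  homo (a , b , c) (a' , b' , c') = begin
    toℕ (a +₃ a') · p ⊕ toℕ (b +₃ b') · q ⊕ toℕ (c +₃ c') · r
      ≡⟨ cong₂ _⊕_ (cong₂ _⊕_ (·-distrib a a' p) (·-distrib b b' q)) (·-distrib c c' r) ⟩
    (A ⊕ A') ⊕ (B ⊕ B') ⊕ (C ⊕ C')
      ≡⟨ cong (_⊕ (C ⊕ C')) (⊕-interchange A A' B B') ⟩
    (A ⊕ B) ⊕ (A' ⊕ B') ⊕ (C ⊕ C')
      ≡⟨ ⊕-interchange (A ⊕ B) (A' ⊕ B') C C' ⟩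
    (A ⊕ B ⊕ C) ⊕ (A' ⊕ B' ⊕ C') ∎
    where
    open ≡-Reasoning
    A = toℕ a · p ; A' = toℕ a' · p
    B = toℕ b · q ; B' = toℕ b' · q
    C = toℕ c · r ; C' = toℕ c' · r

lin-e1 : ∀ p q r → lin p q r e1 ≡ p
lin-e1 p q r = trans (cong₂ _⊕_ (cong₂ _⊕_ (·-one p) (·-zero q)) (·-zero r))
  (trans (⊕-identityʳ _) (⊕-identityʳ p))

lin-e2 : ∀ p q r → lin p q r e2 ≡ q
lin-e2 p q r = trans (cong₂ _⊕_ (cong₂ _⊕_ (·-zero p) (·-one q)) (·-zero r))
  (trans (⊕-identityʳ _) (⊕-identityˡ q))

lin-e3 : ∀ p q r → lin p q r e3 ≡ r
lin-e3 p q r = trans (cong₂ _⊕_ (cong₂ _⊕_ (·-zero p) (·-zero q)) (·-one r)) (⊕-identityˡ r)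

TrivialKernel : (G → G) → Set
TrivialKernel ψ = ∀ x → ψ x ≡ 0G → x ≡ 0G

record Aut : Set where
  field
    f g       : G → G
    f-additive : Additive f
    g-additive : Additive g
    f∘g        : ∀ x → f (g x) ≡ x
    g∘f        : ∀ x → g (f x) ≡ x

  f-kernel : TrivialKernel f
  f-kernel x fx≡0 = trans (sym (g∘f x)) (trans (cong g fx≡0) (additive-zero g-additive))

inverse : Aut → Aut
inverse A = record { f = g ; g = f ; f-additive = g-additive ; g-additive = f-additive
                   ; f∘g = g∘f ; g∘f = f∘g }
  where open Aut A

_then_ : Aut → Aut → Aut
A then B = record
  { f = λ x → B.f (A.f x) ; g = λ x → A.g (B.g x)
  ; f-additive = additive λ x y → trans (cong B.f (⊕-homo A.f-additive x y)) (⊕-homo B.f-additive _ _)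
  ; g-additive = additive λ x y → trans (cong A.g (⊕-homo B.g-additive x y)) (⊕-homo A.g-additive _ _)
  ; f∘g = λ x → trans (cong B.f (A.f∘g (B.g x))) (B.f∘g x)
  ; g∘f = λ x → trans (cong A.g (B.g∘f (A.f x))) (A.g∘f x) }
  where
  module A = Aut A
  module B = Aut B

basis-map : ∀ (A : Aut) {e₁ e₂ e₃} → IsBasis e₁ e₂ e₃ → IsBasis (Aut.f A e₁) (Aut.f A e₂) (Aut.f A e₃)
basis-map A {e₁} {e₂} {e₃} ((n₁ , n₂ , n₃) , independent , generating) =
  (nonzero n₁ , nonzero n₂ , nonzero n₃) , independent′ , generating′
  where
  open Aut A
  nonzero : ∀ {e} → ¬ (e ≡ 0G) → ¬ (f e ≡ 0G)
  nonzero e≢0 fe≡0 = e≢0 (f-kernel _ fe≡0)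
  image-zero : ∀ m e → m · e ≡ 0G → m · f e ≡ 0G
  image-zero m e eq = trans (sym (additive-· f-additive m e)) (trans (cong f eq) (additive-zero f-additive))
  independent′ : ∀ m₁ m₂ m₃ → m₁ · f e₁ ⊕ m₂ · f e₂ ⊕ m₃ · f e₃ ≡ 0G →
    (m₁ · f e₁ ≡ 0G) × (m₂ · f e₂ ≡ 0G) × (m₃ · f e₃ ≡ 0G)
  independent′ m₁ m₂ m₃ eq =
    let z₁ , z₂ , z₃ = independent m₁ m₂ m₃ (f-kernel _ (trans (additive-combination f-additive m₁ m₂ m₃ e₁ e₂ e₃) eq))
    in image-zero m₁ e₁ z₁ , image-zero m₂ e₂ z₂ , image-zero m₃ e₃ z₃
  generating′ : ∀ x → ∃[ m₁ ] ∃[ m₂ ] ∃[ m₃ ] (x ≡ m₁ · f e₁ ⊕ m₂ · f e₂ ⊕ m₃ · f e₃)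
  generating′ x with generating (g x)
  ... | m₁ , m₂ , m₃ , eq = m₁ , m₂ , m₃ ,
    trans (sym (f∘g x)) (trans (cong f eq) (additive-combination f-additive m₁ m₂ m₃ e₁ e₂ e₃))

·-mod-fin : ∀ m x → m · x ≡ toℕ (m mod 3) · x
·-mod-fin m x = trans (·-mod m x) (cong (_· x) (sym (FinP.toℕ-fromℕ< (m%n<n m 3))))

lin-standard : ∀ x → lin e1 e2 e3 x ≡ x
lin-standard (a , b , c) = toWitness {a? = FinP.all? λ a → FinP.all? λ b → FinP.all? λ c →
  lin e1 e2 e3 (a , b , c) ≟G (a , b , c)} _ a b c

standard-basis : IsBasis e1 e2 e3
standard-basis = ((λ ()) , (λ ()) , (λ ())) , independent , generating
  where
  independent-fin : ∀ k₁ k₂ k₃ → toℕ k₁ · e1 ⊕ toℕ k₂ · e2 ⊕ toℕ k₃ · e3 ≡ 0G →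
    (toℕ k₁ · e1 ≡ 0G) × (toℕ k₂ · e2 ≡ 0G) × (toℕ k₃ · e3 ≡ 0G)
  independent-fin = toWitness {a? = FinP.all? λ k₁ → FinP.all? λ k₂ → FinP.all? λ k₃ →
    ((toℕ k₁ · e1 ⊕ toℕ k₂ · e2 ⊕ toℕ k₃ · e3) ≟G 0G) →-dec
    (((toℕ k₁ · e1) ≟G 0G) ×-dec ((toℕ k₂ · e2) ≟G 0G) ×-dec ((toℕ k₃ · e3) ≟G 0G))} _
  independent : ∀ m₁ m₂ m₃ → m₁ · e1 ⊕ m₂ · e2 ⊕ m₃ · e3 ≡ 0G →
    (m₁ · e1 ≡ 0G) × (m₂ · e2 ≡ 0G) × (m₃ · e3 ≡ 0G)
  independent m₁ m₂ m₃ eq =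
    let z₁ , z₂ , z₃ = independent-fin (m₁ mod 3) (m₂ mod 3) (m₃ mod 3)
          (trans (sym (cong₂ _⊕_ (cong₂ _⊕_ (·-mod-fin m₁ e1) (·-mod-fin m₂ e2)) (·-mod-fin m₃ e3))) eq)
    in trans (·-mod-fin m₁ e1) z₁ , trans (·-mod-fin m₂ e2) z₂ , trans (·-mod-fin m₃ e3) z₃
  generating : ∀ x → ∃[ m₁ ] ∃[ m₂ ] ∃[ m₃ ] (x ≡ m₁ · e1 ⊕ m₂ · e2 ⊕ m₃ · e3)
  generating x@(a , b , c) = toℕ a , toℕ b , toℕ c , sym (lin-standard x)

scalar-kills : ∀ (k : Z3) {e} → ¬ (e ≡ 0G) → toℕ k · e ≡ 0G → k ≡ F0
scalar-kills F0 e≢0 _ = refl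
scalar-kills F1 {e} e≢0 one·e≡0 = ⊥-elim (e≢0 (trans (sym (·-one e)) one·e≡0))
scalar-kills F2 {e} e≢0 two·e≡0 = ⊥-elim (e≢0 (·-two-zero e two·e≡0))

basis-kernel : ∀ {p q r} → IsBasis p q r → TrivialKernel (lin p q r)
basis-kernel ((p≢0 , q≢0 , r≢0) , independent , _) (k₁ , k₂ , k₃) eq
  with independent (toℕ k₁) (toℕ k₂) (toℕ k₃) eq
... | z₁ , z₂ , z₃ = triple-≡ (scalar-kills k₁ p≢0 z₁) (scalar-kills k₂ q≢0 z₂) (scalar-kills k₃ r≢0 z₃)

σ-++ : ∀ V W → σ (V ++ W) ≡ σ V ⊕ σ W
σ-++ [] W = sym (⊕-identityˡ (σ W))
σ-++ (x ∷ V) W = trans (cong (x ⊕_) (σ-++ V W)) (sym (⊕-assoc x (σ V) (σ W)))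

σ-↭ : ∀ {U V} → U ↭ V → σ U ≡ σ V
σ-↭ refl = refl
σ-↭ (prep x p) = cong (x ⊕_) (σ-↭ p)
σ-↭ (swap {xs} {ys} x y p) = trans (sym (⊕-assoc x y (σ xs)))
  (trans (cong₂ _⊕_ (⊕-comm x y) (σ-↭ p)) (⊕-assoc y x (σ ys)))
σ-↭ (↭-trans p q) = trans (σ-↭ p) (σ-↭ q)

σ-map : ∀ {f} → Additive f → ∀ U → σ (map f U) ≡ f (σ U)
σ-map f-additive [] = sym (additive-zero f-additive)
σ-map {f} f-additive (x ∷ U) =
  trans (cong (f x ⊕_) (σ-map f-additive U)) (sym (⊕-homo f-additive x (σ U)))

move-to-front : ∀ (x : G) V W → x ∷ V ++ W ↭ V ++ x ∷ W
move-to-front x V W = ↭-sym (shift x V W)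

remove-right : ∀ {x : G} {L} V W₁ W₂ → x ∷ L ↭ V ++ (W₁ ++ x ∷ W₂) → L ↭ V ++ (W₁ ++ W₂)
remove-right {x} V W₁ W₂ p = drop-∷ (↭-trans p (↭-trans (↭-reflexive (sym (++-assoc V W₁ (x ∷ W₂))))
  (↭-trans (↭-sym (move-to-front x (V ++ W₁) W₂)) (↭-reflexive (cong (x ∷_) (++-assoc V W₁ W₂))))))

remove-left : ∀ {x : G} {L} V₁ V₂ W → x ∷ L ↭ (V₁ ++ x ∷ V₂) ++ W → L ↭ (V₁ ++ V₂) ++ W
remove-left {x} V₁ V₂ W p = drop-∷ (↭-trans p (↭-trans (↭-reflexive (++-assoc V₁ (x ∷ V₂) W))
  (↭-trans (↭-sym (move-to-front x V₁ (V₂ ++ W))) (↭-reflexive (cong (x ∷_) (sym (++-assoc V₁ V₂ W)))))))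

ZeroSumFree : Seq → Set
ZeroSumFree S = ∀ V W → S ↭ V ++ W → ¬ (V ≡ []) → ¬ (σ V ≡ 0G)

zsf-↭ : ∀ {S S'} → S ↭ S' → ZeroSumFree S → ZeroSumFree S'
zsf-↭ p zsf V W q = zsf V W (↭-trans p q)

zsf-++ˡ : ∀ A B → ZeroSumFree (A ++ B) → ZeroSumFree A
zsf-++ˡ A B zsf V W p = zsf V (W ++ B) (↭-trans (++⁺ʳ B p) (↭-reflexive (++-assoc V W B)))

subsums : Seq → List G
subsums [] = []
subsums (x ∷ L) = x ∷ (subsums L ++ map (x ⊕_) (subsums L))

IsSubsum : Seq → G → Set
IsSubsum L s = Σ[ V ∈ Seq ] Σ[ W ∈ Seq ] (L ↭ V ++ W) × ¬ (V ≡ []) × σ V ≡ s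

subsums-sound : ∀ L {s} → s ∈ subsums L → IsSubsum L s
subsums-sound (x ∷ L) (here refl) = [ x ] , L , ↭-refl , (λ ()) , ⊕-identityʳ x
subsums-sound (x ∷ L) (there i) with ∈-++⁻ (subsums L) i
... | inj₁ j with subsums-sound L j
...   | V , W , p , V≢[] , σV = V , x ∷ W , ↭-trans (prep x p) (move-to-front x V W) , V≢[] , σV
subsums-sound (x ∷ L) (there i) | inj₂ j with ∈-map⁻ (x ⊕_) j
... | t , t∈ , refl with subsums-sound L t∈
...   | V , W , p , _ , σV = x ∷ V , W , prep x p , (λ ()) , cong (x ⊕_) σV

subsums-complete : ∀ L V W → L ↭ V ++ W → ¬ (V ≡ []) → σ V ∈ subsums L
subsums-complete [] [] W p V≢[] = ⊥-elim (V≢[] refl)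
subsums-complete [] (_ ∷ _) W p V≢[] with () ← ↭-empty-inv (↭-sym p)
subsums-complete (x ∷ L) V W p V≢[] with ∈-++⁻ V (∈-resp-↭ p (here refl))
... | inj₂ x∈W with ∈-∃++ x∈W
...   | W₁ , W₂ , refl = there (∈-++⁺ˡ (subsums-complete L V (W₁ ++ W₂) (remove-right V W₁ W₂ p) V≢[]))
subsums-complete (x ∷ L) V W p V≢[] | inj₁ x∈V with ∈-∃++ x∈V
... | V₁ , V₂ , refl = with-rest (V₁ ++ V₂) (remove-left V₁ V₂ W p) (σ-↭ (shift x V₁ V₂))
  where
  -- V = x · R: either R is empty (σ V = x) or σ V = x + σ R with σ R a subsum of L
  with-rest : ∀ R → L ↭ R ++ W → σ (V₁ ++ x ∷ V₂) ≡ x ⊕ σ R → σ (V₁ ++ x ∷ V₂) ∈ subsums (x ∷ L)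
  with-rest [] _ eq = here (trans eq (⊕-identityʳ x))
  with-rest (r ∷ R) q eq = there (∈-++⁺ʳ (subsums L) (subst (_∈ map (x ⊕_) (subsums L)) (sym eq)
    (∈-map⁺ (x ⊕_) (subsums-complete L (r ∷ R) W q (λ ())))))

zsf⇒0∉subsums : ∀ S → ZeroSumFree S → 0G ∉ subsums S
zsf⇒0∉subsums S zsf 0∈ with subsums-sound S 0∈
... | V , W , p , V≢[] , σV≡0 = zsf V W p V≢[] σV≡0

0∉subsums⇒zsf : ∀ S → 0G ∉ subsums S → ZeroSumFree S
0∉subsums⇒zsf S 0∉ V W p V≢[] σV≡0 = 0∉ (subst (_∈ subsums S) σV≡0 (subsums-complete S V W p V≢[]))

zero-sum-free? : ∀ S → Dec (ZeroSumFree S)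
zero-sum-free? S = map′ (0∉subsums⇒zsf S) (zsf⇒0∉subsums S) (¬? (0G ∈? subsums S))

-- An atom x·R is exactly a zero-sum sequence whose tail R (hence every proper subsequence) is zero-sum free.
atom⇒zsf-tail : ∀ x S → IsAtom (x ∷ S) → ZeroSumFree S
atom⇒zsf-tail x S (_ , _ , minimal) V W p V≢[] =
  minimal V (x ∷ W) (↭-trans (prep x p) (move-to-front x V W)) V≢[] (λ ())

zsf-tail⇒atom : ∀ x R → σ (x ∷ R) ≡ 0G → ZeroSumFree R → IsAtom (x ∷ R)
zsf-tail⇒atom x R σ≡0 zsf = (λ ()) , σ≡0 , minimal
  where
  -- a zero-sum factorisation x·R = V·W splits off x from one factor; the other one is a
  -- nonempty zero-sum subsequence of R
  minimal : ∀ V W → x ∷ R ↭ V ++ W → ¬ (V ≡ []) → ¬ (W ≡ []) → ¬ (σ V ≡ 0G)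
  minimal V W p V≢[] W≢[] σV≡0 with ∈-++⁻ V (∈-resp-↭ p (here refl))
  ... | inj₂ x∈W with ∈-∃++ x∈W
  ...   | W₁ , W₂ , refl = zsf V (W₁ ++ W₂) (remove-right V W₁ W₂ p) V≢[] σV≡0
  minimal V W p V≢[] W≢[] σV≡0 | inj₁ x∈V with ∈-∃++ x∈V
  ... | V₁ , V₂ , refl = zsf W (V₁ ++ V₂) (↭-trans (remove-left V₁ V₂ W p) (++-comm (V₁ ++ V₂) W)) W≢[] σW≡0
    where
    σW≡0 : σ W ≡ 0G
    σW≡0 = trans (sym (⊕-identityˡ (σ W))) (trans (cong (_⊕ σ W) (sym σV≡0))
             (trans (sym (σ-++ (V₁ ++ x ∷ V₂) W)) (trans (sym (σ-↭ p)) σ≡0)))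

atom? : ∀ U → Dec (IsAtom U)
atom? [] = no λ atom → proj₁ atom refl
atom? (x ∷ R) = map′ (λ (σ≡0 , zsf) → zsf-tail⇒atom x R σ≡0 zsf)
                     (λ atom → proj₁ (proj₂ atom) , atom⇒zsf-tail x R atom)
                     ((σ (x ∷ R) ≟G 0G) ×-dec zero-sum-free? R)

atom-↭ : ∀ {U U'} → U ↭ U' → IsAtom U' → IsAtom U
atom-↭ {U} {U'} p (U'≢[] , σ≡0 , minimal) =
  (λ U≡[] → U'≢[] (↭-empty-inv (↭-sym (subst (_↭ U') U≡[] p)))) ,
  trans (σ-↭ p) σ≡0 ,
  λ V W q → minimal V W (↭-trans (↭-sym p) q)

subsums-map : ∀ {ψ} → Additive ψ → ∀ R → subsums (map ψ R) ≡ map ψ (subsums R)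
subsums-map ψ-additive [] = refl
subsums-map {ψ} ψ-additive (x ∷ R) = cong (ψ x ∷_) (begin
  subsums (map ψ R) ++ map (ψ x ⊕_) (subsums (map ψ R))
    ≡⟨ cong (λ l → l ++ map (ψ x ⊕_) l) (subsums-map ψ-additive R) ⟩
  map ψ S ++ map (ψ x ⊕_) (map ψ S)
    ≡⟨ cong (map ψ S ++_) (shifted S) ⟩
  map ψ S ++ map ψ (map (x ⊕_) S)
    ≡⟨ sym (map-++ ψ S (map (x ⊕_) S)) ⟩
  map ψ (S ++ map (x ⊕_) S) ∎)
  where
  open ≡-Reasoning
  S = subsums R
  shifted : ∀ l → map (ψ x ⊕_) (map ψ l) ≡ map ψ (map (x ⊕_) l)
  shifted [] = refl
  shifted (y ∷ l) = cong₂ _∷_ (sym (⊕-homo ψ-additive x y)) (shifted l)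

zsf-map : ∀ {ψ} → Additive ψ → TrivialKernel ψ → ∀ R → ZeroSumFree R → ZeroSumFree (map ψ R)
zsf-map {ψ} ψ-additive ker R zsf = 0∉subsums⇒zsf (map ψ R) 0∉
  where
  0∉ : ¬ (0G ∈ subsums (map ψ R))
  0∉ 0∈ with ∈-map⁻ ψ (subst (0G ∈_) (subsums-map ψ-additive R) 0∈)
  ... | s , s∈ , 0≡ψs = zsf⇒0∉subsums R zsf (subst (_∈ subsums R) (ker s (sym 0≡ψs)) s∈)

zsf-aut : ∀ (A : Aut) S → ZeroSumFree S → ZeroSumFree (map (Aut.f A) S)
zsf-aut A = zsf-map (Aut.f-additive A) (Aut.f-kernel A)

atom-map : ∀ {ψ} → Additive ψ → TrivialKernel ψ → ∀ U → IsAtom U → IsAtom (map ψ U)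
atom-map ψ-additive ker [] atom = ⊥-elim (proj₁ atom refl)
atom-map {ψ} ψ-additive ker (x ∷ R) atom = zsf-tail⇒atom (ψ x) (map ψ R)
  (trans (σ-map ψ-additive (x ∷ R)) (trans (cong ψ (proj₁ (proj₂ atom))) (additive-zero ψ-additive)))
  (zsf-map ψ-additive ker R (atom⇒zsf-tail x R atom))

bSequence : G → G → G → ℕ → ℕ → ℕ → ℕ → ℕ → ℕ → ℕ → ℕ → Seq
bSequence e₁ e₂ e₃ a₁ a₂ a₃ a₄ a₅ b₁ b₂ b₃ =
  e₁ ∷ e₁ ∷ (a₁ · e₁ ⊕ e₂) ∷ (a₂ · e₁ ⊕ e₂) ∷
  (a₃ · e₁ ⊕ b₁ · e₂ ⊕ e₃) ∷ (a₄ · e₁ ⊕ b₂ · e₂ ⊕ e₃) ∷ (a₅ · e₁ ⊕ b₃ · e₂ ⊕ e₃) ∷ []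

map-bSequence : ∀ {f} → Additive f → ∀ e₁ e₂ e₃ a₁ a₂ a₃ a₄ a₅ b₁ b₂ b₃ →
  map f (bSequence e₁ e₂ e₃ a₁ a₂ a₃ a₄ a₅ b₁ b₂ b₃) ≡ bSequence (f e₁) (f e₂) (f e₃) a₁ a₂ a₃ a₄ a₅ b₁ b₂ b₃
map-bSequence {f} f-additive e₁ e₂ e₃ a₁ a₂ a₃ a₄ a₅ b₁ b₂ b₃ =
  cong (λ t → f e₁ ∷ f e₁ ∷ t) (cong₂ _∷_ (second a₁) (cong₂ _∷_ (second a₂)
    (cong₂ _∷_ (third a₃ b₁) (cong₂ _∷_ (third a₄ b₂) (cong₂ _∷_ (third a₅ b₃) refl)))))
  where
  second : ∀ a → f (a · e₁ ⊕ e₂) ≡ a · f e₁ ⊕ f e₂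
  second a = trans (⊕-homo f-additive _ _) (cong (_⊕ f e₂) (additive-· f-additive a e₁))
  third : ∀ a b → f (a · e₁ ⊕ b · e₂ ⊕ e₃) ≡ a · f e₁ ⊕ b · f e₂ ⊕ f e₃
  third a b = trans (⊕-homo f-additive _ _) (cong (_⊕ f e₃) (trans (⊕-homo f-additive _ _)
    (cong₂ _⊕_ (additive-· f-additive a e₁) (additive-· f-additive b e₂))))

condB-↭ : ∀ {U U'} → U ↭ U' → CondB U' → CondB U
condB-↭ p (e₁ , e₂ , e₃ , basis , a₁ , a₂ , a₃ , a₄ , a₅ , b₁ , b₂ , b₃ , bounds , sa , sb , q) =
  e₁ , e₂ , e₃ , basis , a₁ , a₂ , a₃ , a₄ , a₅ , b₁ , b₂ , b₃ , bounds , sa , sb , ↭-trans p q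

map-inverse : ∀ (A : Aut) L → map (Aut.g A) (map (Aut.f A) L) ≡ L
map-inverse A [] = refl
map-inverse A (x ∷ L) = cong₂ _∷_ (Aut.g∘f A x) (map-inverse A L)

condB-map : ∀ (A : Aut) U → CondB (map (Aut.f A) U) → CondB U
condB-map A U (e₁ , e₂ , e₃ , basis , a₁ , a₂ , a₃ , a₄ , a₅ , b₁ , b₂ , b₃ , bounds , sa , sb , q) =
  g e₁ , g e₂ , g e₃ , basis-map (inverse A) basis , a₁ , a₂ , a₃ , a₄ , a₅ , b₁ , b₂ , b₃ , bounds , sa , sb ,
  subst₂ _↭_ (map-inverse A U) (map-bSequence g-additive e₁ e₂ e₃ a₁ a₂ a₃ a₄ a₅ b₁ b₂ b₃) (map⁺ g q)
  where open Aut A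

δ : G → G → ℕ
δ g x with g ≟G x
... | yes _ = 1
... | no _ = 0

v-∷ : ∀ g x U → v g (x ∷ U) ≡ δ g x + v g U
v-∷ g x U with g ≟G x
... | yes _ = refl
... | no _ = refl

v-↭ : ∀ g {U U'} → U ↭ U' → v g U ≡ v g U'
v-↭ g refl = refl
v-↭ g (prep {xs} {ys} x p) = trans (v-∷ g x xs) (trans (cong (δ g x +_) (v-↭ g p)) (sym (v-∷ g x ys)))
v-↭ g (swap {xs} {ys} x y p) = begin
  v g (x ∷ y ∷ xs)           ≡⟨ trans (v-∷ g x (y ∷ xs)) (cong (δ g x +_) (v-∷ g y xs)) ⟩
  δ g x + (δ g y + v g xs)   ≡⟨ ℕP.+-comm (δ g x) _ ⟩
  (δ g y + v g xs) + δ g x   ≡⟨ ℕP.+-assoc (δ g y) _ _ ⟩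
  δ g y + (v g xs + δ g x)   ≡⟨ cong (δ g y +_) (ℕP.+-comm (v g xs) _) ⟩
  δ g y + (δ g x + v g xs)   ≡⟨ cong (λ n → δ g y + (δ g x + n)) (v-↭ g p) ⟩
  δ g y + (δ g x + v g ys)   ≡⟨ sym (trans (v-∷ g y (x ∷ ys)) (cong (δ g y +_) (v-∷ g x ys))) ⟩
  v g (y ∷ x ∷ ys)           ∎
  where open ≡-Reasoning
v-↭ g (↭-trans p q) = trans (v-↭ g p) (v-↭ g q)

v-map : ∀ (A : Aut) g U → v (Aut.f A g) (map (Aut.f A) U) ≡ v g U
v-map A g [] = refl
v-map A g (x ∷ U) with Aut.f A g ≟G Aut.f A x | g ≟G x
... | yes _ | yes _ = cong suc (v-map A g U)
... | no _  | no _  = v-map A g U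
... | yes fg≡fx | no g≢x = ⊥-elim (g≢x (trans (sym (Aut.g∘f A g)) (trans (cong (Aut.g A) fg≡fx) (Aut.g∘f A x))))
... | no fg≢fx | yes refl = ⊥-elim (fg≢fx refl)

HeightTwo : Seq → Set
HeightTwo U = (∀ g → v g U ≤ 2) × (∃[ g ] v g U ≡ 2)

heightTwo-↭ : ∀ {U U'} → U ↭ U' → HeightTwo U' → HeightTwo U
heightTwo-↭ p (bound , g , v≡2) =
  (λ g' → subst (_≤ 2) (sym (v-↭ g' p)) (bound g')) , g , trans (v-↭ g p) v≡2

heightTwo-map : ∀ (A : Aut) U → HeightTwo (map (Aut.f A) U) → HeightTwo U
heightTwo-map A U (bound , g , v≡2) =
  (λ g' → subst (_≤ 2) (v-map A g' U) (bound (Aut.f A g'))) , Aut.g A g ,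
  trans (sym (v-map A (Aut.g A g) U)) (trans (cong (λ z → v z (map (Aut.f A) U)) (Aut.f∘g A g)) v≡2)

allG-complete : ∀ x → x ∈ allG
allG-complete (a , b , c) = ∈-cartesianProduct⁺ (∈-allFin a) (∈-cartesianProduct⁺ (∈-allFin b) (∈-allFin c))

heightTwo⇒h≡2 : ∀ U → HeightTwo U → h U ≡ 2
heightTwo⇒h≡2 U (bound , g , v≡2) =
  ℕP.≤-antisym (max≤ _ bound-on-list) (subst (_≤ h U) v≡2 (≤max _ (∈-map⁺ (λ g → v g U) (allG-complete g))))
  where
  max≤ : ∀ (ns : List ℕ) → (∀ {n} → n ∈ ns → n ≤ 2) → foldr _⊔_ 0 ns ≤ 2
  max≤ [] _ = z≤n
  max≤ (n ∷ ns) all≤ = ℕP.⊔-lub (all≤ (here refl)) (max≤ ns (λ i → all≤ (there i)))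
  ≤max : ∀ (ns : List ℕ) {n} → n ∈ ns → n ≤ foldr _⊔_ 0 ns
  ≤max (n ∷ ns) (here refl) = ℕP.m≤m⊔n n _
  ≤max (n ∷ ns) (there i) = ℕP.≤-trans (≤max ns i) (ℕP.m≤n⊔m n _)
  bound-on-list : ∀ {n} → n ∈ map (λ g → v g U) allG → n ≤ 2
  bound-on-list i with ∈-map⁻ (λ g → v g U) i
  ... | g' , _ , refl = bound g'

-- Boolean tests.  Only the Boolean part of a decision is ever computed; the soundness lemmas
-- turn a successful test into a proof.
T-∨-elim : ∀ {a b} → T (a ∨ b) → T a ⊎ T b
T-∨-elim = Equivalence.to T-∨

∧-split : ∀ a {b} → T (a ∧ b) → T a × T b
∧-split a = Equivalence.to (T-∧ {a})

T-not : ∀ {b} → ¬ T b → T (not b)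
T-not {false} _ = _
T-not {true} ¬tt = ¬tt _

T-implies : ∀ a {b} → T (not a ∨ b) → T a → T b
T-implies true ok _ = ok
T-implies false _ ()

_==_ : G → G → Bool
x == y = isYes (x ≟G y)

==-sound : ∀ {x y} → T (x == y) → x ≡ y
==-sound {x} {y} = toWitness {a? = x ≟G y}

everywhere : (G → Bool) → Bool
everywhere p = isYes (All.all? (λ x → T? (p x)) allG)

everywhere-sound : ∀ p → T (everywhere p) → ∀ x → T (p x)
everywhere-sound p ok x = All.lookup (toWitness {a? = All.all? (λ x → T? (p x)) allG} ok) (allG-complete x)

-- (p, q, r) is a basis, witnessed by the inverse (p′, q′, r′) of the coordinate map lin p q r.
record LinAut (p q r : G) : Set where
  field
    p′ q′ r′ : G
    inverseˡ : ∀ x → lin p′ q′ r′ (lin p q r x) ≡ x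
    inverseʳ : ∀ x → lin p q r (lin p′ q′ r′ x) ≡ x

linAut : ∀ {p q r} → LinAut p q r → Aut
linAut {p} {q} {r} L = record
  { f = lin p q r ; g = lin p′ q′ r′ ; f-additive = lin-additive p q r ; g-additive = lin-additive p′ q′ r′
  ; f∘g = inverseʳ ; g∘f = inverseˡ }
  where open LinAut L

-- Cramer's rule over C₃: the inverse of the matrix with columns p, q, r has rows
-- (q × r)/det, (r × p)/det, (p × q)/det, and 1/det = det when det ≠ 0.
_*₃_ _-₃_ : Z3 → Z3 → Z3
a *₃ b = toℕ a ·₃ b
a -₃ b = a +₃ (2 ·₃ b)

cross : G → G → G
cross (a₁ , a₂ , a₃) (b₁ , b₂ , b₃) =
  ((a₂ *₃ b₃) -₃ (a₃ *₃ b₂)) , ((a₃ *₃ b₁) -₃ (a₁ *₃ b₃)) , ((a₁ *₃ b₂) -₃ (a₂ *₃ b₁))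

dot : G → G → Z3
dot (a₁ , a₂ , a₃) (b₁ , b₂ , b₃) = (a₁ *₃ b₁) +₃ ((a₂ *₃ b₂) +₃ (a₃ *₃ b₃))

columns : G → G → G → G × G × G
columns (x₁ , x₂ , x₃) (y₁ , y₂ , y₃) (z₁ , z₂ , z₃) = (x₁ , y₁ , z₁) , (x₂ , y₂ , z₂) , (x₃ , y₃ , z₃)

inverseColumns : G → G → G → G × G × G
inverseColumns p q r = columns (d · cross q r) (d · cross r p) (d · cross p q)
  where d = toℕ (dot p (cross q r))

-- A linear map is determined by the images of the standard basis: if lin p′ q′ r′ sends
-- p, q, r to e1, e2, e3, then it is a left inverse of lin p q r.
inverse-on-basis : ∀ p q r p′ q′ r′ → lin p′ q′ r′ p ≡ e1 → lin p′ q′ r′ q ≡ e2 → lin p′ q′ r′ r ≡ e3 →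
  ∀ x → lin p′ q′ r′ (lin p q r x) ≡ x
inverse-on-basis p q r p′ q′ r′ p↦ q↦ r↦ x@(a , b , c) = begin
  lin p′ q′ r′ (toℕ a · p ⊕ toℕ b · q ⊕ toℕ c · r)
    ≡⟨ additive-combination (lin-additive p′ q′ r′) (toℕ a) (toℕ b) (toℕ c) p q r ⟩
  toℕ a · lin p′ q′ r′ p ⊕ toℕ b · lin p′ q′ r′ q ⊕ toℕ c · lin p′ q′ r′ r
    ≡⟨ cong₂ _⊕_ (cong₂ _⊕_ (cong (toℕ a ·_) p↦) (cong (toℕ b ·_) q↦)) (cong (toℕ c ·_) r↦) ⟩
  lin e1 e2 e3 x
    ≡⟨ lin-standard x ⟩
  x ∎
  where open ≡-Reasoning

inverse-equations : G → G → G → G → G → G → List (G × G)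
inverse-equations p q r p′ q′ r′ =
  (lin p′ q′ r′ p , e1) ∷ (lin p′ q′ r′ q , e2) ∷ (lin p′ q′ r′ r , e3) ∷
  (lin p q r p′ , e1) ∷ (lin p q r q′ , e2) ∷ (lin p q r r′ , e3) ∷ []

from-equations : ∀ {p q r} p′ q′ r′ → All (λ (x , y) → x ≡ y) (inverse-equations p q r p′ q′ r′) → LinAut p q r
from-equations {p} {q} {r} p′ q′ r′ (p↦ ∷ q↦ ∷ r↦ ∷ p′↦ ∷ q′↦ ∷ r′↦ ∷ []) = record
  { p′ = p′ ; q′ = q′ ; r′ = r′
  ; inverseˡ = inverse-on-basis p q r p′ q′ r′ p↦ q↦ r↦
  ; inverseʳ = inverse-on-basis p′ q′ r′ p q r p′↦ q′↦ r′↦ }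

-- Computing LinAut: check the six equations for the candidate inverse.  Only the Boolean part
-- of the decision is inspected, so the equality proofs are never evaluated.
linAut? : ∀ p q r → Maybe (LinAut p q r)
linAut? p q r = decide (All.all? (λ (x , y) → x ≟G y) (inverse-equations p q r p′ q′ r′))
  where
  p′ = proj₁ (inverseColumns p q r)
  q′ = proj₁ (proj₂ (inverseColumns p q r))
  r′ = proj₂ (proj₂ (inverseColumns p q r))
  decide : Dec (All (λ (x , y) → x ≡ y) (inverse-equations p q r p′ q′ r′)) → Maybe (LinAut p q r)
  decide (true because equations) = just (from-equations p′ q′ r′ (invert equations))
  decide (false because _) = nothing

normaliser : ∀ {p q r} → LinAut p q r →
  Σ[ A ∈ Aut ] (Aut.f A p ≡ e1 × Aut.f A q ≡ e2 × Aut.f A r ≡ e3)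
normaliser {p} {q} {r} L =
  inverse (linAut L) ,
  trans (cong g (sym (lin-e1 p q r))) (inverseˡ e1) ,
  trans (cong g (sym (lin-e2 p q r))) (inverseˡ e2) ,
  trans (cong g (sym (lin-e3 p q r))) (inverseˡ e3)
  where
  open LinAut L
  g = lin p′ q′ r′

inLine inPlane : G → Bool
inLine (_ , b , c) = isYes (b FinP.≟ F0) ∧ isYes (c FinP.≟ F0)
inPlane (_ , _ , c) = isYes (c FinP.≟ F0)

extension₁? : ∀ x → Maybe (∃[ y ] ∃[ z ] LinAut x y z)
extension₁? x = Maybe.map (λ L → e2 , e3 , L) (linAut? x e2 e3)
            <∣> Maybe.map (λ L → e1 , e3 , L) (linAut? x e1 e3)
            <∣> Maybe.map (λ L → e1 , e2 , L) (linAut? x e1 e2)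

extension₂? : ∀ x → Maybe (∃[ z ] LinAut e1 x z)
extension₂? x = Maybe.map (e3 ,_) (linAut? e1 x e3) <∣> Maybe.map (e2 ,_) (linAut? e1 x e2)

extend₁ : ∀ x → ¬ (x ≡ 0G) → ∃[ y ] ∃[ z ] LinAut x y z
extend₁ x x≢0 with T-∨-elim (everywhere-sound (λ x → (x == 0G) ∨ is-just (extension₁? x)) _ x)
... | inj₁ x≡0 = ⊥-elim (x≢0 (==-sound x≡0))
... | inj₂ ok = to-witness-T (extension₁? x) ok

extend₂ : ∀ x → ¬ T (inLine x) → ∃[ z ] LinAut e1 x z
extend₂ x x∉line with T-∨-elim (everywhere-sound (λ x → inLine x ∨ is-just (extension₂? x)) _ x)
... | inj₁ x∈line = ⊥-elim (x∉line x∈line)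
... | inj₂ ok = to-witness-T (extension₂? x) ok

extend₃ : ∀ x → ¬ T (inPlane x) → LinAut e1 e2 x
extend₃ x x∉plane with T-∨-elim (everywhere-sound (λ x → inPlane x ∨ is-just (linAut? e1 e2 x)) _ x)
... | inj₁ x∈plane = ⊥-elim (x∉plane x∈plane)
... | inj₂ ok = to-witness-T (linAut? e1 e2 x) ok

normalise₁ : ∀ x → ¬ (x ≡ 0G) → Σ[ A ∈ Aut ] Aut.f A x ≡ e1
normalise₁ x x≢0 = let (_ , _ , L) = extend₁ x x≢0 ; (A , x↦ , _) = normaliser L in A , x↦

normalise₂ : ∀ x → ¬ T (inLine x) → Σ[ A ∈ Aut ] (Aut.f A e1 ≡ e1 × Aut.f A x ≡ e2)
normalise₂ x x∉line = let (_ , L) = extend₂ x x∉line ; (A , e1↦ , x↦ , _) = normaliser L in A , e1↦ , x↦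

normalise₃ : ∀ x → ¬ T (inPlane x) → Σ[ A ∈ Aut ] (Aut.f A e1 ≡ e1 × Aut.f A e2 ≡ e2 × Aut.f A x ≡ e3)
normalise₃ x x∉plane = normaliser (extend₃ x x∉plane)

code : G → ℕ
code (a , b , c) = 9 * toℕ a + 3 * toℕ b + toℕ c

closesZeroSum : G → List G → Bool
closesZeroSum g st = (g == 0G) ∨ isYes (Any.any? (λ s → (g ⊕ s) ≟G 0G) st)

-- All sequences R·L, where R consists of n elements satisfying ok, listed in ascending order of
-- codes (all at least lo), pruning every branch that produces a nonempty zero-sum subsequence.
-- The argument st carries the subsums of L.
extensions : (G → Bool) → ℕ → Seq → List G → ℕ → List Seq

branch : (G → Bool) → ℕ → Seq → List G → ℕ → G → List Seq
branch ok n L st lo g =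
  if (lo ≤ᵇ code g) ∧ (ok g ∧ not (closesZeroSum g st))
  then extensions ok n (g ∷ L) (g ∷ (st ++ map (g ⊕_) st)) (code g)
  else []

extensions ok zero L st lo = L ∷ []
extensions ok (suc n) L st lo = concatMap (branch ok n L st lo) allG

data Ascending : ℕ → Seq → Set where
  []  : ∀ {lo} → Ascending lo []
  _∷_ : ∀ {lo g R} → lo ≤ code g → Ascending (code g) R → Ascending lo (g ∷ R)

closesZeroSum-sound : ∀ g L R → ZeroSumFree (g ∷ R ++ L) → ¬ T (closesZeroSum g (subsums L))
closesZeroSum-sound g L R zsf closes with T-∨-elim closes
... | inj₁ g≡0 = zsf [ g ] (R ++ L) ↭-refl (λ ()) (trans (⊕-identityʳ g) (==-sound g≡0))
... | inj₂ hit with find (toWitness hit)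
...   | s , s∈ , g+s≡0 with subsums-sound L s∈
...     | V , W , L↭ , V≢[] , σV≡s =
  zsf (g ∷ V) (R ++ W) (prep g (↭-trans (++⁺ˡ R L↭) (shifts R V))) (λ ()) (trans (cong (g ⊕_) σV≡s) g+s≡0)

∈-if-true : ∀ {b} {xs ys : List Seq} {M} → T b → M ∈ xs → M ∈ (if b then xs else ys)
∈-if-true {true} _ M∈ = M∈

extensions-complete : ∀ ok n L lo R → length R ≡ n → All (T ∘ ok) R → Ascending lo R → ZeroSumFree (R ++ L) →
  Σ[ M ∈ Seq ] M ∈ extensions ok n L (subsums L) lo × M ↭ R ++ L
extensions-complete ok zero L lo [] _ _ _ _ = L , here refl , ↭-refl
extensions-complete ok (suc n) L lo (g ∷ R) len (okg ∷ okR) (lo≤g ∷ asc) zsf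
  with extensions-complete ok n (g ∷ L) (code g) R (ℕP.suc-injective len) okR asc (zsf-↭ (move-to-front g R L) zsf)
... | M , M∈ , M↭ =
  M , ∈-concatMap⁺ (branch ok n L (subsums L) lo) (lose (allG-complete g) (∈-if-true taken M∈)) ,
  ↭-trans M↭ (↭-sym (move-to-front g R L))
  where
  taken : T ((lo ≤ᵇ code g) ∧ (ok g ∧ not (closesZeroSum g (subsums L))))
  taken = Equivalence.from T-∧ (ℕP.≤⇒≤ᵇ lo≤g , Equivalence.from T-∧ (okg , T-not (closesZeroSum-sound g L R zsf)))

-- Sorting by code makes any sequence ascending.
open import Data.List.Sort (On.decTotalOrder ℕP.≤-decTotalOrder code) using (sort; sort-↭; sort-↗)

linked⇒ascending : ∀ {lo g R} → lo ≤ code g → Linked (λ x y → code x ≤ code y) (g ∷ R) → Ascending lo (g ∷ R)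
linked⇒ascending lo≤g [-] = lo≤g ∷ []
linked⇒ascending lo≤g (g≤h ∷ linked) = lo≤g ∷ linked⇒ascending g≤h linked

sorted⇒ascending : ∀ R → Linked (λ x y → code x ≤ code y) R → Ascending 0 R
sorted⇒ascending [] _ = []
sorted⇒ascending (g ∷ R) linked = linked⇒ascending z≤n linked

extensions-cover : ∀ ok n L R → length R ≡ n → All (T ∘ ok) R → ZeroSumFree (R ++ L) →
  Σ[ M ∈ Seq ] M ∈ extensions ok n L (subsums L) 0 × M ↭ R ++ L
extensions-cover ok n L R len okR zsf
  with extensions-complete ok n L 0 (sort R) (trans (↭-length (sort-↭ R)) len)
         (All-resp-↭ (↭-sym (sort-↭ R)) okR) (sorted⇒ascending (sort R) (sort-↗ R))
         (zsf-↭ (++⁺ʳ L (↭-sym (sort-↭ R))) zsf)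
... | M , M∈ , M↭ = M , M∈ , ↭-trans M↭ (++⁺ʳ L (sort-↭ R))

prefix-extension : ∀ ok n L k R → length R ≡ n + k → All (T ∘ ok) R → ZeroSumFree (L ++ R) →
  length (take n R) ≡ n × All (T ∘ ok) (take n R) × ZeroSumFree (take n R ++ L)
prefix-extension ok n L k R len okR zsf =
  trans (length-take n R) (trans (cong (n ⊓_) len) (ℕP.m≤n⇒m⊓n≡m (ℕP.m≤m+n n k))) ,
  ++⁻ˡ (take n R) (subst (All (T ∘ ok)) (sym (take++drop≡id n R)) okR) ,
  zsf-↭ (++-comm L (take n R)) (zsf-++ˡ (L ++ take n R) (drop n R) (subst ZeroSumFree split zsf))
  where
  split : L ++ R ≡ (L ++ take n R) ++ drop n R
  split = trans (cong (L ++_) (sym (take++drop≡id n R))) (sym (++-assoc L (take n R) (drop n R)))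

no-extension : ∀ ok n L k R → extensions ok n L (subsums L) 0 ≡ [] →
  length R ≡ n + k → All (T ∘ ok) R → ¬ ZeroSumFree (L ++ R)
no-extension ok n L k R none len okR zsf =
  let len′ , ok′ , zsf′ = prefix-extension ok n L k R len okR zsf
      M , M∈ , _ = extensions-cover ok n L (take n R) len′ ok′ zsf′
  in ∉[] (subst (M ∈_) none M∈)

-- The three exhaustive searches: there is no zero-sum free sequence consisting of e1 and five
-- more elements of ⟨e1⟩, of e1, e2 and four more elements of ⟨e1, e2⟩, or of e1, e2, e3 and
-- four more elements.
no-zsf-line : extensions inLine 5 (e1 ∷ []) (subsums (e1 ∷ [])) 0 ≡ []
no-zsf-line = refl

no-zsf-plane : extensions inPlane 4 (e1 ∷ e2 ∷ []) (subsums (e1 ∷ e2 ∷ [])) 0 ≡ []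
no-zsf-plane = refl

no-zsf-space : extensions (λ _ → true) 4 (e1 ∷ e2 ∷ e3 ∷ []) (subsums (e1 ∷ e2 ∷ e3 ∷ [])) 0 ≡ []
no-zsf-space = refl

sums-ok : ℕ → ℕ → ℕ → ℕ → ℕ → ℕ → ℕ → ℕ → Bool
sums-ok a₁ a₂ a₃ a₄ a₅ b₁ b₂ b₃ = isYes ((a₁ + a₂ + a₃ + a₄ + a₅) % 3 ≟ 1) ∧ isYes ((b₁ + b₂ + b₃) % 3 ≟ 1)

all-digits : ∀ n → (Vec ℕ n → Bool) → Bool
all-digits zero p = p []
all-digits (suc n) p = for-digit λ a → all-digits n (λ as → p (a ∷ as))
  where
  for-digit : (ℕ → Bool) → Bool
  for-digit q = q 0 ∧ (q 1 ∧ q 2)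

all-digits-sound : ∀ n p → T (all-digits n p) → ∀ as → VecAll.All (_≤ 2) as → T (p as)
all-digits-sound zero p ok [] [] = ok
all-digits-sound (suc n) p ok (a ∷ as) (a≤2 ∷ as≤2) =
  all-digits-sound n (λ as → p (a ∷ as)) (at-digit a a≤2) as as≤2
  where
  q = λ a → all-digits n (λ as → p (a ∷ as))
  at-digit : ∀ a → a ≤ 2 → T (q a)
  at-digit 0 _ = proj₁ (Equivalence.to (T-∧ {q 0}) ok)
  at-digit 1 _ = proj₁ (Equivalence.to (T-∧ {q 1}) (proj₂ (Equivalence.to (T-∧ {q 0}) ok)))
  at-digit 2 _ = proj₂ (Equivalence.to (T-∧ {q 1}) (proj₂ (Equivalence.to (T-∧ {q 0}) ok)))
  at-digit (suc (suc (suc _))) (s≤s (s≤s ()))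

-- The parameters violate the sum condition of (b), or the standard sequence is an atom.
-- The test is opaque so that the exhaustive check below is evaluated only once.
opaque
  atom-test : Vec ℕ 8 → Bool
  atom-test (a₁ ∷ a₂ ∷ a₃ ∷ a₄ ∷ a₅ ∷ b₁ ∷ b₂ ∷ b₃ ∷ []) =
    not (sums-ok a₁ a₂ a₃ a₄ a₅ b₁ b₂ b₃) ∨ isYes (atom? (bSequence e1 e2 e3 a₁ a₂ a₃ a₄ a₅ b₁ b₂ b₃))

opaque
  unfolding atom-test

  standard-bSequences-are-atoms : T (all-digits 8 atom-test)
  standard-bSequences-are-atoms = _

  atom-test-sound : ∀ a₁ a₂ a₃ a₄ a₅ b₁ b₂ b₃ → T (atom-test (a₁ ∷ a₂ ∷ a₃ ∷ a₄ ∷ a₅ ∷ b₁ ∷ b₂ ∷ b₃ ∷ [])) →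
    T (sums-ok a₁ a₂ a₃ a₄ a₅ b₁ b₂ b₃) → IsAtom (bSequence e1 e2 e3 a₁ a₂ a₃ a₄ a₅ b₁ b₂ b₃)
  atom-test-sound a₁ a₂ a₃ a₄ a₅ b₁ b₂ b₃ tested sums =
    toWitness (T-implies (sums-ok a₁ a₂ a₃ a₄ a₅ b₁ b₂ b₃) tested sums)

remove : (x : G) (ys : Seq) → Maybe (Σ[ zs ∈ Seq ] ys ↭ x ∷ zs)
remove x [] = nothing
remove x (y ∷ ys) with x ≟G y
... | true because x≡y = just (ys , ↭-reflexive (cong (_∷ ys) (sym (invert x≡y))))
... | false because _ = Maybe.map (λ (zs , ys↭) → y ∷ zs , ↭-trans (prep y ys↭) (swap y x ↭-refl)) (remove x ys)

perm? : (xs ys : Seq) → Maybe (xs ↭ ys)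
perm? [] [] = just ↭-refl
perm? [] (_ ∷ _) = nothing
perm? (x ∷ xs) ys with remove x ys
... | nothing = nothing
... | just (zs , ys↭) = Maybe.map (λ xs↭zs → ↭-trans (prep x xs↭zs) (↭-sym ys↭)) (perm? xs zs)

-- The multiplicity v, computed with the Boolean part of x ≟G y only.
count : G → Seq → ℕ
count g [] = 0
count g (x ∷ U) = if g == x then suc (count g U) else count g U

count≡v : ∀ g U → count g U ≡ v g U
count≡v g [] = refl
count≡v g (x ∷ U) with g ≟G x
... | yes _ = cong suc (count≡v g U)
... | no _ = count≡v g U

heightTwo? : Seq → Bool
heightTwo? U = everywhere (λ g → count g U ≤ᵇ 2) ∧ isYes (Any.any? (λ g → count g U ≟ 2) allG)

heightTwo?-sound : ∀ U → T (heightTwo? U) → HeightTwo U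
heightTwo?-sound U ok =
  let bounded , attained = ∧-split (everywhere (λ g → count g U ≤ᵇ 2)) ok
      g , _ , count≡2 = find (toWitness {a? = Any.any? (λ g → count g U ≟ 2) allG} attained)
  in (λ g′ → subst (_≤ 2) (count≡v g′ U) (ℕP.≤ᵇ⇒≤ (count g′ U) 2 (everywhere-sound (λ g → count g U ≤ᵇ 2) bounded g′))) ,
     g , trans (sym (count≡v g U)) count≡2

-- A certificate that U satisfies (b): a basis given by the images p, q, r of the standard
-- basis, and the parameters a₁ … a₅, b₁ b₂ b₃.
record Certificate : Set where
  constructor certificate
  field
    p q r : G
    a₁ a₂ a₃ a₄ a₅ b₁ b₂ b₃ : ℕ

valid : Seq → Certificate → Bool
valid U (certificate p q r a₁ a₂ a₃ a₄ a₅ b₁ b₂ b₃) =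
  is-just (linAut? p q r) ∧
  (isYes (All.all? (_≤? 2) (a₁ ∷ a₂ ∷ a₃ ∷ a₄ ∷ a₅ ∷ b₁ ∷ b₂ ∷ b₃ ∷ [])) ∧
  (sums-ok a₁ a₂ a₃ a₄ a₅ b₁ b₂ b₃ ∧
  (is-just (perm? U (bSequence (lin p q r e1) (lin p q r e2) (lin p q r e3) a₁ a₂ a₃ a₄ a₅ b₁ b₂ b₃)) ∧
  heightTwo? U)))

valid-sound : ∀ U c → T (valid U c) → CondB U × HeightTwo U
valid-sound U (certificate p q r a₁ a₂ a₃ a₄ a₅ b₁ b₂ b₃) ok =
  let basis-ok , rest = ∧-split (is-just basis?) ok
      bounds-ok , rest = ∧-split (isYes bounds?) rest
      sums , rest = ∧-split (sums-ok a₁ a₂ a₃ a₄ a₅ b₁ b₂ b₃) rest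
      perm-ok , height-ok = ∧-split (is-just perm) rest
      sa , sb = ∧-split (isYes ((a₁ + a₂ + a₃ + a₄ + a₅) % 3 ≟ 1)) sums
  in (lin p q r e1 , lin p q r e2 , lin p q r e3 ,
      basis-map (linAut (to-witness-T basis? basis-ok)) standard-basis ,
      a₁ , a₂ , a₃ , a₄ , a₅ , b₁ , b₂ , b₃ , bounds (toWitness {a? = bounds?} bounds-ok) ,
      toWitness sa , toWitness sb , to-witness-T perm perm-ok) ,
     heightTwo?-sound U height-ok
  where
  basis? = linAut? p q r
  bounds? = All.all? (_≤? 2) (a₁ ∷ a₂ ∷ a₃ ∷ a₄ ∷ a₅ ∷ b₁ ∷ b₂ ∷ b₃ ∷ [])
  perm = perm? U (bSequence (lin p q r e1) (lin p q r e2) (lin p q r e3) a₁ a₂ a₃ a₄ a₅ b₁ b₂ b₃)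
  bounds : All (_≤ 2) (a₁ ∷ a₂ ∷ a₃ ∷ a₄ ∷ a₅ ∷ b₁ ∷ b₂ ∷ b₃ ∷ []) →
    a₁ ≤ 2 × a₂ ≤ 2 × a₃ ≤ 2 × a₄ ≤ 2 × a₅ ≤ 2 × b₁ ≤ 2 × b₂ ≤ 2 × b₃ ≤ 2
  bounds (l₁ ∷ l₂ ∷ l₃ ∷ l₄ ∷ l₅ ∷ l₆ ∷ l₇ ∷ l₈ ∷ []) = l₁ , l₂ , l₃ , l₄ , l₅ , l₆ , l₇ , l₈

-- The zero-sum completion x·M of a sequence M, x = -σ(M).
completion : Seq → Seq
completion M = 2 · σ M ∷ M

all-certified : List Seq → List Certificate → Bool
all-certified [] [] = true
all-certified (M ∷ Ms) (c ∷ cs) = valid (completion M) c ∧ all-certified Ms cs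
all-certified _ _ = false

all-certified-sound : ∀ Ms cs → T (all-certified Ms cs) → ∀ {M} → M ∈ Ms →
  ∃[ c ] T (valid (completion M) c)
all-certified-sound (M ∷ Ms) (c ∷ cs) ok (here refl) = c , proj₁ (∧-split (valid (completion M) c) ok)
all-certified-sound (M ∷ Ms) (c ∷ cs) ok (there M∈) = all-certified-sound Ms cs (proj₂ (∧-split (valid (completion M) c) ok)) M∈

-- The normalised zero-sum free sequences e1·e2·e3·R of length 6, up to order.  Opaque, so that
-- the list is computed only where its certificates are checked.
opaque
  leaves : List Seq
  leaves = extensions (λ _ → true) 3 (e1 ∷ e2 ∷ e3 ∷ []) (subsums (e1 ∷ e2 ∷ e3 ∷ [])) 0

-- One certificate for each leaf, in the order of the leaves.
certificates : List Certificate
certificates =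
  certificate (F1 , F0 , F0) (F0 , F1 , F0) (F1 , F1 , F1) 0 0 0 2 2 0 2 2 ∷
  certificate (F0 , F1 , F0) (F1 , F1 , F0) (F1 , F0 , F1) 0 2 0 1 1 0 2 2 ∷
  certificate (F0 , F1 , F0) (F1 , F1 , F2) (F0 , F0 , F1) 0 2 0 2 0 0 1 0 ∷
  certificate (F0 , F1 , F0) (F1 , F1 , F0) (F1 , F0 , F1) 0 2 0 1 1 0 2 2 ∷
  certificate (F1 , F0 , F0) (F0 , F1 , F0) (F1 , F1 , F1) 0 0 0 2 2 0 2 2 ∷
  certificate (F0 , F1 , F0) (F1 , F0 , F2) (F0 , F0 , F1) 0 1 0 0 0 0 1 0 ∷
  certificate (F0 , F1 , F0) (F1 , F2 , F0) (F1 , F2 , F1) 0 1 0 0 0 0 2 2 ∷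
  certificate (F0 , F1 , F0) (F1 , F2 , F0) (F1 , F2 , F1) 0 1 0 0 0 0 2 2 ∷
  certificate (F1 , F2 , F2) (F0 , F1 , F0) (F0 , F0 , F1) 0 0 0 1 0 0 1 0 ∷
  certificate (F1 , F0 , F0) (F1 , F1 , F0) (F0 , F1 , F1) 0 2 0 1 1 0 2 2 ∷
  certificate (F0 , F0 , F1) (F1 , F0 , F1) (F1 , F1 , F2) 0 2 0 0 2 0 2 2 ∷
  certificate (F0 , F0 , F1) (F1 , F0 , F2) (F1 , F1 , F1) 0 1 0 2 1 0 2 2 ∷
  certificate (F1 , F0 , F0) (F1 , F1 , F0) (F0 , F1 , F1) 0 2 0 1 1 0 2 2 ∷
  certificate (F0 , F0 , F1) (F1 , F0 , F2) (F1 , F1 , F1) 0 1 0 2 1 0 2 2 ∷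
  certificate (F0 , F0 , F1) (F1 , F0 , F1) (F1 , F1 , F2) 0 2 0 0 2 0 2 2 ∷
  certificate (F1 , F2 , F0) (F0 , F0 , F1) (F0 , F1 , F1) 0 0 0 1 0 0 2 2 ∷
  certificate (F0 , F0 , F1) (F1 , F2 , F2) (F0 , F1 , F1) 0 2 0 0 2 0 1 0 ∷
  certificate (F0 , F0 , F1) (F1 , F2 , F1) (F0 , F1 , F1) 0 1 0 1 2 0 1 0 ∷
  certificate (F1 , F0 , F0) (F1 , F1 , F2) (F0 , F0 , F1) 0 2 0 2 0 0 1 0 ∷
  certificate (F0 , F0 , F1) (F1 , F0 , F1) (F1 , F1 , F1) 0 2 0 2 0 0 2 2 ∷
  certificate (F0 , F0 , F1) (F1 , F0 , F2) (F1 , F1 , F0) 0 1 0 1 2 0 2 2 ∷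
  certificate (F0 , F0 , F1) (F1 , F0 , F2) (F1 , F1 , F0) 0 1 0 1 2 0 2 2 ∷
  certificate (F0 , F0 , F1) (F1 , F0 , F1) (F1 , F1 , F1) 0 2 0 2 0 0 2 2 ∷
  certificate (F1 , F0 , F0) (F1 , F1 , F2) (F0 , F0 , F1) 0 2 0 2 0 0 1 0 ∷
  certificate (F0 , F0 , F1) (F1 , F2 , F2) (F0 , F1 , F2) 0 1 0 2 1 0 1 0 ∷
  certificate (F1 , F2 , F1) (F0 , F1 , F2) (F0 , F0 , F1) 0 1 0 0 0 0 1 0 ∷
  certificate (F0 , F0 , F1) (F1 , F2 , F0) (F0 , F1 , F2) 0 2 0 1 1 0 1 0 ∷
  certificate (F1 , F0 , F0) (F1 , F1 , F0) (F0 , F1 , F1) 0 2 0 1 1 0 2 2 ∷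
  certificate (F0 , F1 , F0) (F1 , F0 , F0) (F1 , F1 , F1) 0 0 0 2 2 0 2 2 ∷
  certificate (F1 , F0 , F0) (F0 , F1 , F2) (F0 , F0 , F1) 0 1 0 0 0 0 1 0 ∷
  certificate (F1 , F0 , F0) (F2 , F1 , F0) (F2 , F1 , F1) 0 1 0 0 0 0 2 2 ∷
  certificate (F1 , F0 , F0) (F2 , F1 , F0) (F2 , F1 , F1) 0 1 0 0 0 0 2 2 ∷
  certificate (F2 , F1 , F2) (F1 , F0 , F0) (F0 , F0 , F1) 0 0 0 1 0 0 1 0 ∷
  certificate (F0 , F1 , F0) (F1 , F1 , F0) (F1 , F0 , F1) 0 2 0 1 1 0 2 2 ∷
  certificate (F0 , F0 , F1) (F0 , F1 , F2) (F1 , F1 , F1) 0 1 0 2 1 0 2 2 ∷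
  certificate (F0 , F0 , F1) (F0 , F1 , F1) (F1 , F1 , F2) 0 2 0 0 2 0 2 2 ∷
  certificate (F2 , F1 , F0) (F0 , F0 , F1) (F1 , F0 , F1) 0 0 0 0 1 0 2 2 ∷
  certificate (F0 , F0 , F1) (F2 , F1 , F2) (F1 , F0 , F1) 0 2 0 2 0 0 0 1 ∷
  certificate (F0 , F0 , F1) (F2 , F1 , F1) (F1 , F0 , F1) 0 1 0 2 1 0 0 1 ∷
  certificate (F0 , F0 , F1) (F0 , F1 , F2) (F1 , F1 , F0) 0 1 0 1 2 0 2 2 ∷
  certificate (F0 , F0 , F1) (F0 , F1 , F1) (F1 , F1 , F1) 0 2 0 2 0 0 2 2 ∷
  certificate (F0 , F1 , F0) (F1 , F1 , F2) (F0 , F0 , F1) 0 2 0 2 0 0 1 0 ∷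
  certificate (F0 , F0 , F1) (F2 , F1 , F2) (F1 , F0 , F2) 0 1 0 1 2 0 0 1 ∷
  certificate (F2 , F1 , F1) (F1 , F0 , F2) (F0 , F0 , F1) 0 1 0 0 0 0 1 0 ∷
  certificate (F0 , F0 , F1) (F2 , F1 , F0) (F1 , F0 , F2) 0 2 0 1 1 0 0 1 ∷
  certificate (F1 , F2 , F0) (F0 , F0 , F1) (F0 , F1 , F1) 0 0 0 1 0 0 2 2 ∷
  certificate (F0 , F1 , F0) (F1 , F2 , F0) (F1 , F2 , F1) 0 1 0 0 0 0 2 2 ∷
  certificate (F0 , F0 , F1) (F0 , F1 , F2) (F1 , F2 , F2) 0 1 0 1 2 0 0 1 ∷
  certificate (F1 , F2 , F1) (F0 , F1 , F2) (F0 , F0 , F1) 0 1 0 0 0 0 1 0 ∷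
  certificate (F0 , F0 , F1) (F0 , F1 , F1) (F1 , F2 , F2) 0 2 0 2 0 0 0 1 ∷
  certificate (F0 , F1 , F0) (F1 , F2 , F2) (F0 , F0 , F1) 0 0 0 1 0 0 1 0 ∷
  certificate (F2 , F1 , F0) (F0 , F0 , F1) (F1 , F0 , F1) 0 0 0 0 1 0 2 2 ∷
  certificate (F1 , F0 , F0) (F2 , F1 , F0) (F2 , F1 , F1) 0 1 0 0 0 0 2 2 ∷
  certificate (F0 , F0 , F1) (F1 , F0 , F2) (F2 , F1 , F2) 0 1 0 1 2 0 0 1 ∷
  certificate (F2 , F1 , F1) (F1 , F0 , F2) (F0 , F0 , F1) 0 1 0 0 0 0 1 0 ∷
  certificate (F0 , F0 , F1) (F1 , F0 , F1) (F2 , F1 , F2) 0 2 0 2 0 0 0 1 ∷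
  certificate (F1 , F0 , F0) (F2 , F1 , F2) (F0 , F0 , F1) 0 0 0 1 0 0 1 0 ∷
  certificate (F1 , F0 , F0) (F1 , F0 , F1) (F0 , F1 , F1) 0 2 0 1 1 0 2 2 ∷
  certificate (F1 , F0 , F0) (F1 , F0 , F1) (F0 , F1 , F1) 0 2 0 1 1 0 2 2 ∷
  certificate (F1 , F0 , F2) (F0 , F1 , F0) (F0 , F1 , F1) 0 0 0 1 0 0 2 2 ∷
  certificate (F0 , F1 , F0) (F1 , F1 , F0) (F1 , F2 , F1) 0 2 0 0 2 0 2 2 ∷
  certificate (F0 , F1 , F0) (F1 , F2 , F0) (F1 , F1 , F1) 0 1 0 2 1 0 2 2 ∷
  certificate (F0 , F1 , F0) (F1 , F2 , F2) (F0 , F1 , F1) 0 2 0 0 2 0 1 0 ∷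
  certificate (F0 , F1 , F0) (F1 , F2 , F0) (F1 , F1 , F1) 0 1 0 2 1 0 2 2 ∷
  certificate (F0 , F1 , F0) (F1 , F1 , F0) (F1 , F2 , F1) 0 2 0 0 2 0 2 2 ∷
  certificate (F0 , F1 , F0) (F1 , F1 , F2) (F0 , F1 , F1) 0 1 0 1 2 0 1 0 ∷
  certificate (F1 , F0 , F0) (F1 , F2 , F1) (F0 , F1 , F0) 0 2 0 0 2 0 0 1 ∷
  certificate (F0 , F1 , F0) (F1 , F2 , F0) (F1 , F0 , F1) 0 1 0 1 2 0 2 2 ∷
  certificate (F0 , F1 , F0) (F1 , F2 , F2) (F0 , F2 , F1) 0 1 0 2 1 0 1 0 ∷
  certificate (F0 , F1 , F0) (F1 , F1 , F0) (F1 , F1 , F1) 0 2 0 2 0 0 2 2 ∷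
  certificate (F0 , F1 , F0) (F1 , F1 , F0) (F1 , F1 , F1) 0 2 0 2 0 0 2 2 ∷
  certificate (F1 , F1 , F2) (F0 , F2 , F1) (F0 , F1 , F0) 0 1 0 0 0 0 0 1 ∷
  certificate (F0 , F1 , F0) (F1 , F2 , F0) (F1 , F0 , F1) 0 1 0 1 2 0 2 2 ∷
  certificate (F1 , F0 , F0) (F1 , F2 , F1) (F0 , F1 , F0) 0 2 0 0 2 0 0 1 ∷
  certificate (F0 , F1 , F0) (F1 , F0 , F2) (F0 , F2 , F1) 0 2 0 1 1 0 1 0 ∷
  certificate (F1 , F0 , F0) (F1 , F0 , F1) (F0 , F1 , F1) 0 2 0 1 1 0 2 2 ∷
  certificate (F0 , F0 , F1) (F1 , F0 , F0) (F1 , F1 , F1) 0 0 0 2 2 0 2 2 ∷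
  certificate (F1 , F0 , F0) (F0 , F2 , F1) (F0 , F1 , F0) 0 1 0 0 0 0 0 1 ∷
  certificate (F1 , F0 , F0) (F2 , F0 , F1) (F2 , F1 , F1) 0 1 0 0 0 0 2 2 ∷
  certificate (F1 , F0 , F0) (F2 , F0 , F1) (F2 , F1 , F1) 0 1 0 0 0 0 2 2 ∷
  certificate (F2 , F2 , F1) (F1 , F0 , F0) (F0 , F1 , F0) 0 0 0 0 1 0 0 1 ∷
  certificate (F0 , F0 , F1) (F1 , F0 , F1) (F1 , F1 , F0) 0 2 0 1 1 0 2 2 ∷
  certificate (F0 , F1 , F0) (F0 , F2 , F1) (F1 , F2 , F0) 0 1 0 2 1 0 1 0 ∷
  certificate (F1 , F0 , F2) (F0 , F1 , F0) (F0 , F1 , F1) 0 0 0 1 0 0 2 2 ∷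
  certificate (F0 , F0 , F1) (F1 , F0 , F2) (F1 , F1 , F2) 0 1 0 0 0 0 2 2 ∷
  certificate (F0 , F1 , F0) (F0 , F2 , F1) (F1 , F2 , F2) 0 1 0 1 2 0 0 1 ∷
  certificate (F0 , F1 , F0) (F0 , F2 , F1) (F1 , F1 , F1) 0 1 0 2 1 0 2 2 ∷
  certificate (F0 , F1 , F0) (F0 , F1 , F1) (F1 , F2 , F1) 0 2 0 0 2 0 2 2 ∷
  certificate (F2 , F0 , F1) (F0 , F1 , F0) (F1 , F1 , F0) 0 0 0 0 1 0 2 2 ∷
  certificate (F0 , F1 , F0) (F2 , F2 , F1) (F1 , F1 , F0) 0 2 0 2 0 0 0 1 ∷
  certificate (F0 , F1 , F0) (F2 , F1 , F1) (F1 , F1 , F0) 0 1 0 2 1 0 0 1 ∷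
  certificate (F0 , F1 , F0) (F0 , F1 , F1) (F1 , F2 , F0) 0 2 0 1 1 0 1 0 ∷
  certificate (F1 , F1 , F2) (F0 , F2 , F1) (F0 , F1 , F0) 0 1 0 0 0 0 0 1 ∷
  certificate (F0 , F1 , F0) (F0 , F1 , F1) (F1 , F2 , F2) 0 2 0 2 0 0 0 1 ∷
  certificate (F0 , F0 , F1) (F1 , F2 , F1) (F0 , F1 , F0) 0 2 0 2 0 0 1 0 ∷
  certificate (F0 , F1 , F0) (F2 , F2 , F1) (F1 , F2 , F0) 0 1 0 1 2 0 0 1 ∷
  certificate (F2 , F1 , F1) (F1 , F2 , F0) (F0 , F1 , F0) 0 1 0 0 0 0 1 0 ∷
  certificate (F0 , F1 , F0) (F2 , F0 , F1) (F1 , F2 , F0) 0 2 0 1 1 0 0 1 ∷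
  certificate (F0 , F0 , F1) (F1 , F2 , F2) (F0 , F1 , F0) 0 0 0 1 0 0 1 0 ∷
  certificate (F2 , F0 , F1) (F0 , F1 , F0) (F1 , F1 , F0) 0 0 0 0 1 0 2 2 ∷
  certificate (F1 , F0 , F0) (F2 , F0 , F1) (F2 , F1 , F1) 0 1 0 0 0 0 2 2 ∷
  certificate (F0 , F1 , F0) (F1 , F2 , F0) (F2 , F2 , F1) 0 1 0 1 2 0 0 1 ∷
  certificate (F2 , F1 , F1) (F1 , F2 , F0) (F0 , F1 , F0) 0 1 0 0 0 0 1 0 ∷
  certificate (F0 , F1 , F0) (F1 , F1 , F0) (F2 , F2 , F1) 0 2 0 2 0 0 0 1 ∷
  certificate (F1 , F0 , F0) (F2 , F2 , F1) (F0 , F1 , F0) 0 0 0 0 1 0 0 1 ∷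
  certificate (F0 , F1 , F0) (F1 , F0 , F0) (F1 , F0 , F1) 0 0 0 1 0 0 2 2 ∷
  certificate (F0 , F0 , F1) (F1 , F0 , F0) (F1 , F1 , F0) 0 0 0 1 0 0 2 2 ∷
  certificate (F1 , F0 , F0) (F2 , F1 , F0) (F2 , F0 , F1) 0 1 0 2 1 0 1 0 ∷
  certificate (F1 , F0 , F0) (F2 , F0 , F1) (F2 , F1 , F0) 0 1 0 2 1 0 1 0 ∷
  certificate (F0 , F0 , F1) (F1 , F0 , F1) (F1 , F1 , F2) 0 2 0 0 2 0 2 2 ∷
  certificate (F0 , F1 , F0) (F1 , F0 , F2) (F0 , F1 , F1) 0 0 0 2 2 0 1 0 ∷
  certificate (F0 , F0 , F1) (F1 , F0 , F2) (F1 , F1 , F1) 0 1 0 2 1 0 2 2 ∷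
  certificate (F0 , F1 , F0) (F1 , F1 , F0) (F1 , F2 , F1) 0 2 0 0 2 0 2 2 ∷
  certificate (F0 , F1 , F0) (F1 , F2 , F0) (F1 , F1 , F1) 0 1 0 2 1 0 2 2 ∷
  certificate (F0 , F1 , F0) (F1 , F2 , F2) (F0 , F1 , F1) 0 2 0 0 2 0 1 0 ∷
  certificate (F2 , F0 , F1) (F1 , F1 , F2) (F0 , F1 , F1) 0 1 0 1 2 0 2 2 ∷
  certificate (F0 , F0 , F1) (F1 , F2 , F0) (F0 , F1 , F1) 0 0 0 2 2 0 1 0 ∷
  certificate (F0 , F0 , F1) (F1 , F2 , F2) (F0 , F1 , F1) 0 2 0 0 2 0 1 0 ∷
  certificate (F2 , F1 , F0) (F1 , F2 , F1) (F0 , F1 , F1) 0 1 0 1 2 0 2 2 ∷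
  certificate (F2 , F0 , F1) (F1 , F1 , F2) (F0 , F1 , F1) 0 1 0 1 2 0 2 2 ∷
  certificate (F1 , F0 , F0) (F2 , F1 , F0) (F2 , F0 , F1) 0 1 0 2 1 0 1 0 ∷
  certificate (F2 , F1 , F0) (F1 , F2 , F1) (F0 , F1 , F1) 0 1 0 1 2 0 2 2 ∷
  certificate (F1 , F0 , F0) (F1 , F0 , F1) (F0 , F1 , F2) 0 2 0 0 2 0 0 1 ∷
  certificate (F1 , F0 , F0) (F1 , F0 , F1) (F0 , F1 , F2) 0 2 0 0 2 0 0 1 ∷
  certificate (F1 , F0 , F2) (F0 , F1 , F2) (F1 , F0 , F0) 0 0 0 2 2 0 1 0 ∷
  certificate (F0 , F1 , F2) (F1 , F2 , F1) (F1 , F1 , F0) 0 1 0 2 1 0 2 2 ∷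
  certificate (F0 , F1 , F2) (F1 , F2 , F0) (F1 , F0 , F0) 0 2 0 0 2 0 2 2 ∷
  certificate (F0 , F1 , F2) (F1 , F1 , F2) (F1 , F2 , F2) 0 2 0 0 2 0 2 2 ∷
  certificate (F0 , F1 , F2) (F1 , F1 , F1) (F1 , F0 , F0) 0 1 0 2 1 0 2 2 ∷
  certificate (F0 , F1 , F2) (F1 , F2 , F1) (F1 , F1 , F0) 0 1 0 2 1 0 2 2 ∷
  certificate (F0 , F1 , F2) (F1 , F1 , F2) (F1 , F2 , F2) 0 2 0 0 2 0 2 2 ∷
  certificate (F0 , F1 , F2) (F1 , F0 , F0) (F1 , F0 , F1) 0 0 0 1 0 0 2 2 ∷
  certificate (F0 , F0 , F1) (F1 , F0 , F0) (F1 , F1 , F2) 0 0 0 0 1 0 2 2 ∷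
  certificate (F1 , F0 , F0) (F2 , F1 , F2) (F2 , F0 , F1) 0 1 0 2 1 0 1 0 ∷
  certificate (F1 , F0 , F0) (F2 , F0 , F1) (F2 , F1 , F2) 0 1 0 1 2 0 0 1 ∷
  certificate (F0 , F0 , F1) (F1 , F0 , F1) (F1 , F1 , F1) 0 2 0 2 0 0 2 2 ∷
  certificate (F0 , F1 , F2) (F1 , F0 , F2) (F1 , F0 , F0) 0 0 0 1 0 0 2 2 ∷
  certificate (F0 , F0 , F1) (F1 , F0 , F2) (F1 , F1 , F0) 0 1 0 1 2 0 2 2 ∷
  certificate (F0 , F1 , F2) (F1 , F2 , F1) (F1 , F1 , F0) 0 1 0 2 1 0 2 2 ∷
  certificate (F0 , F1 , F2) (F1 , F2 , F0) (F1 , F0 , F0) 0 2 0 0 2 0 2 2 ∷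
  certificate (F2 , F0 , F1) (F1 , F1 , F1) (F1 , F0 , F0) 0 1 0 2 1 0 1 0 ∷
  certificate (F0 , F1 , F2) (F1 , F1 , F2) (F1 , F2 , F2) 0 2 0 0 2 0 2 2 ∷
  certificate (F0 , F0 , F1) (F1 , F2 , F2) (F0 , F1 , F2) 0 1 0 2 1 0 1 0 ∷
  certificate (F0 , F0 , F1) (F1 , F2 , F1) (F0 , F1 , F2) 0 0 0 0 1 0 1 0 ∷
  certificate (F2 , F1 , F2) (F1 , F2 , F2) (F0 , F1 , F2) 0 1 0 2 1 0 0 1 ∷
  certificate (F2 , F0 , F1) (F1 , F1 , F1) (F1 , F0 , F0) 0 1 0 2 1 0 1 0 ∷
  certificate (F1 , F0 , F0) (F2 , F1 , F2) (F2 , F0 , F1) 0 1 0 2 1 0 1 0 ∷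
  certificate (F2 , F1 , F2) (F1 , F2 , F2) (F0 , F1 , F2) 0 1 0 2 1 0 0 1 ∷
  certificate (F1 , F0 , F0) (F1 , F1 , F0) (F0 , F2 , F1) 0 2 0 0 2 0 0 1 ∷
  certificate (F0 , F2 , F1) (F1 , F1 , F2) (F1 , F0 , F1) 0 1 0 1 2 0 2 2 ∷
  certificate (F0 , F2 , F1) (F1 , F1 , F1) (F1 , F0 , F0) 0 1 0 1 2 0 2 2 ∷
  certificate (F1 , F0 , F0) (F1 , F1 , F0) (F0 , F2 , F1) 0 2 0 0 2 0 0 1 ∷
  certificate (F0 , F2 , F1) (F1 , F0 , F2) (F1 , F0 , F0) 0 2 0 2 0 0 2 2 ∷
  certificate (F0 , F2 , F1) (F1 , F1 , F2) (F1 , F0 , F1) 0 1 0 1 2 0 2 2 ∷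
  certificate (F1 , F2 , F0) (F0 , F2 , F1) (F1 , F0 , F0) 0 0 0 2 2 0 0 1 ∷
  certificate (F0 , F2 , F1) (F1 , F2 , F1) (F1 , F2 , F2) 0 2 0 2 0 0 2 2 ∷
  certificate (F0 , F2 , F1) (F1 , F2 , F1) (F1 , F2 , F2) 0 2 0 2 0 0 2 2 ∷
  certificate (F0 , F2 , F1) (F1 , F0 , F0) (F1 , F1 , F0) 0 0 0 0 1 0 2 2 ∷
  certificate (F0 , F1 , F0) (F1 , F0 , F0) (F1 , F2 , F1) 0 0 0 0 1 0 2 2 ∷
  certificate (F1 , F0 , F0) (F2 , F2 , F1) (F2 , F1 , F0) 0 1 0 1 2 0 0 1 ∷
  certificate (F1 , F0 , F0) (F2 , F1 , F0) (F2 , F2 , F1) 0 1 0 1 2 0 0 1 ∷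
  certificate (F0 , F2 , F1) (F1 , F1 , F2) (F1 , F0 , F1) 0 1 0 1 2 0 2 2 ∷
  certificate (F0 , F1 , F0) (F1 , F2 , F0) (F1 , F0 , F1) 0 1 0 1 2 0 2 2 ∷
  certificate (F0 , F2 , F1) (F1 , F1 , F1) (F1 , F0 , F0) 0 1 0 1 2 0 2 2 ∷
  certificate (F0 , F1 , F0) (F1 , F2 , F2) (F0 , F2 , F1) 0 1 0 2 1 0 1 0 ∷
  certificate (F0 , F1 , F0) (F1 , F1 , F0) (F1 , F1 , F1) 0 2 0 2 0 0 2 2 ∷
  certificate (F2 , F1 , F0) (F1 , F1 , F1) (F1 , F0 , F0) 0 1 0 1 2 0 0 1 ∷
  certificate (F0 , F1 , F0) (F1 , F1 , F2) (F0 , F2 , F1) 0 0 0 0 1 0 1 0 ∷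
  certificate (F0 , F2 , F1) (F1 , F2 , F0) (F1 , F0 , F0) 0 0 0 0 1 0 2 2 ∷
  certificate (F0 , F2 , F1) (F1 , F2 , F1) (F1 , F2 , F2) 0 2 0 2 0 0 2 2 ∷
  certificate (F2 , F2 , F1) (F1 , F2 , F2) (F0 , F2 , F1) 0 1 0 2 1 0 0 1 ∷
  certificate (F2 , F1 , F0) (F1 , F1 , F1) (F1 , F0 , F0) 0 1 0 1 2 0 0 1 ∷
  certificate (F1 , F0 , F0) (F2 , F2 , F1) (F2 , F1 , F0) 0 1 0 1 2 0 0 1 ∷
  certificate (F2 , F2 , F1) (F1 , F2 , F2) (F0 , F2 , F1) 0 1 0 2 1 0 0 1 ∷
  certificate (F1 , F0 , F0) (F1 , F1 , F0) (F2 , F1 , F1) 0 2 0 0 2 0 2 2 ∷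
  certificate (F1 , F0 , F0) (F2 , F1 , F0) (F1 , F1 , F1) 0 1 0 2 1 0 2 2 ∷
  certificate (F1 , F0 , F0) (F2 , F1 , F2) (F1 , F0 , F1) 0 2 0 0 2 0 1 0 ∷
  certificate (F1 , F0 , F0) (F2 , F1 , F0) (F1 , F1 , F1) 0 1 0 2 1 0 2 2 ∷
  certificate (F1 , F0 , F0) (F1 , F1 , F0) (F2 , F1 , F1) 0 2 0 0 2 0 2 2 ∷
  certificate (F1 , F0 , F0) (F1 , F1 , F2) (F1 , F0 , F1) 0 1 0 1 2 0 1 0 ∷
  certificate (F1 , F0 , F0) (F2 , F0 , F1) (F1 , F1 , F1) 0 1 0 2 1 0 2 2 ∷
  certificate (F1 , F0 , F0) (F2 , F2 , F1) (F1 , F1 , F0) 0 2 0 2 0 0 0 1 ∷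
  certificate (F1 , F0 , F0) (F2 , F0 , F1) (F1 , F1 , F1) 0 1 0 2 1 0 2 2 ∷
  certificate (F1 , F0 , F0) (F1 , F0 , F1) (F2 , F1 , F1) 0 2 0 0 2 0 2 2 ∷
  certificate (F1 , F0 , F0) (F1 , F2 , F1) (F1 , F1 , F0) 0 1 0 2 1 0 0 1 ∷
  certificate (F1 , F0 , F0) (F1 , F1 , F0) (F2 , F0 , F1) 0 2 0 1 1 0 1 0 ∷
  certificate (F1 , F0 , F0) (F1 , F0 , F1) (F2 , F1 , F0) 0 2 0 1 1 0 1 0 ∷
  certificate (F1 , F1 , F2) (F2 , F0 , F1) (F1 , F0 , F0) 0 1 0 0 0 0 0 1 ∷
  certificate (F1 , F1 , F2) (F2 , F0 , F1) (F1 , F0 , F0) 0 1 0 0 0 0 0 1 ∷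
  certificate (F1 , F0 , F0) (F1 , F0 , F1) (F2 , F1 , F2) 0 2 0 2 0 0 0 1 ∷
  certificate (F1 , F2 , F1) (F2 , F1 , F0) (F1 , F0 , F0) 0 1 0 0 0 0 0 1 ∷
  certificate (F1 , F2 , F1) (F2 , F1 , F0) (F1 , F0 , F0) 0 1 0 0 0 0 0 1 ∷
  certificate (F1 , F0 , F0) (F1 , F1 , F0) (F2 , F2 , F1) 0 2 0 2 0 0 0 1 ∷
  certificate (F1 , F0 , F0) (F2 , F1 , F0) (F0 , F1 , F1) 0 1 0 1 2 0 2 2 ∷
  certificate (F0 , F1 , F0) (F2 , F1 , F1) (F1 , F0 , F0) 0 2 0 0 2 0 0 1 ∷
  certificate (F1 , F0 , F0) (F0 , F1 , F2) (F2 , F0 , F1) 0 2 0 1 1 0 1 0 ∷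
  certificate (F0 , F0 , F1) (F2 , F1 , F1) (F1 , F0 , F0) 0 2 0 0 2 0 0 1 ∷
  certificate (F1 , F0 , F0) (F0 , F2 , F1) (F2 , F1 , F0) 0 2 0 1 1 0 0 1 ∷
  certificate (F0 , F0 , F1) (F2 , F1 , F2) (F1 , F0 , F0) 0 0 0 0 1 0 0 1 ∷
  certificate (F0 , F1 , F0) (F2 , F2 , F1) (F1 , F0 , F0) 0 0 0 0 1 0 0 1 ∷
  certificate (F1 , F0 , F0) (F1 , F1 , F0) (F2 , F1 , F1) 0 2 0 0 2 0 2 2 ∷
  certificate (F1 , F0 , F0) (F2 , F1 , F0) (F1 , F1 , F1) 0 1 0 2 1 0 2 2 ∷
  certificate (F1 , F0 , F0) (F2 , F1 , F2) (F1 , F0 , F1) 0 2 0 0 2 0 1 0 ∷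
  certificate (F1 , F2 , F0) (F2 , F1 , F1) (F1 , F0 , F1) 0 1 0 2 1 0 2 2 ∷
  certificate (F1 , F2 , F0) (F2 , F1 , F1) (F1 , F0 , F1) 0 1 0 2 1 0 2 2 ∷
  certificate (F0 , F0 , F1) (F2 , F1 , F0) (F1 , F0 , F1) 0 0 0 2 2 0 0 1 ∷
  certificate (F0 , F0 , F1) (F2 , F1 , F2) (F1 , F0 , F1) 0 2 0 2 0 0 0 1 ∷
  certificate (F1 , F0 , F2) (F2 , F1 , F1) (F1 , F1 , F0) 0 1 0 2 1 0 2 2 ∷
  certificate (F1 , F0 , F2) (F2 , F1 , F0) (F1 , F0 , F0) 0 2 0 0 2 0 1 0 ∷
  certificate (F1 , F0 , F2) (F1 , F1 , F2) (F2 , F1 , F2) 0 2 0 0 2 0 2 2 ∷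
  certificate (F1 , F0 , F2) (F1 , F1 , F1) (F1 , F0 , F0) 0 1 0 1 2 0 1 0 ∷
  certificate (F1 , F0 , F2) (F2 , F1 , F1) (F1 , F1 , F0) 0 1 0 2 1 0 2 2 ∷
  certificate (F1 , F0 , F2) (F1 , F1 , F2) (F2 , F1 , F2) 0 2 0 0 2 0 2 2 ∷
  certificate (F1 , F0 , F2) (F2 , F1 , F1) (F1 , F1 , F0) 0 1 0 2 1 0 2 2 ∷
  certificate (F1 , F0 , F2) (F2 , F1 , F0) (F1 , F0 , F0) 0 2 0 0 2 0 1 0 ∷
  certificate (F1 , F0 , F2) (F1 , F1 , F2) (F2 , F1 , F2) 0 2 0 0 2 0 2 2 ∷
  certificate (F1 , F2 , F2) (F2 , F1 , F2) (F1 , F0 , F2) 0 1 0 1 2 0 1 0 ∷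
  certificate (F1 , F2 , F2) (F2 , F1 , F2) (F1 , F0 , F2) 0 1 0 1 2 0 1 0 ∷
  certificate (F0 , F0 , F1) (F2 , F1 , F2) (F1 , F0 , F2) 0 1 0 1 2 0 0 1 ∷
  certificate (F0 , F0 , F1) (F2 , F1 , F1) (F1 , F0 , F2) 0 0 0 1 0 0 0 1 ∷
  certificate (F1 , F0 , F0) (F2 , F0 , F1) (F1 , F1 , F1) 0 1 0 2 1 0 2 2 ∷
  certificate (F1 , F0 , F0) (F2 , F2 , F1) (F1 , F1 , F0) 0 2 0 2 0 0 0 1 ∷
  certificate (F0 , F1 , F0) (F2 , F0 , F1) (F1 , F1 , F0) 0 0 0 2 2 0 0 1 ∷
  certificate (F0 , F1 , F0) (F2 , F2 , F1) (F1 , F1 , F0) 0 2 0 2 0 0 0 1 ∷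
  certificate (F1 , F2 , F0) (F2 , F0 , F1) (F1 , F0 , F0) 0 2 0 2 0 0 0 1 ∷
  certificate (F1 , F2 , F0) (F2 , F0 , F1) (F1 , F0 , F0) 0 2 0 2 0 0 0 1 ∷
  certificate (F2 , F0 , F1) (F0 , F1 , F2) (F1 , F0 , F0) 0 2 0 1 1 0 1 0 ∷
  certificate (F2 , F1 , F0) (F0 , F2 , F1) (F1 , F0 , F0) 0 2 0 1 1 0 0 1 ∷
  certificate (F1 , F1 , F2) (F2 , F1 , F2) (F1 , F2 , F2) 0 2 0 2 0 0 0 1 ∷
  certificate (F1 , F0 , F0) (F2 , F0 , F1) (F1 , F1 , F2) 0 1 0 0 0 0 0 1 ∷
  certificate (F1 , F1 , F2) (F1 , F2 , F2) (F2 , F1 , F2) 0 2 0 2 0 0 0 1 ∷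
  certificate (F1 , F1 , F2) (F2 , F1 , F2) (F1 , F2 , F2) 0 2 0 2 0 0 0 1 ∷
  certificate (F2 , F0 , F1) (F1 , F1 , F2) (F0 , F1 , F1) 0 1 0 1 2 0 2 2 ∷
  certificate (F1 , F2 , F0) (F1 , F2 , F1) (F2 , F2 , F1) 0 2 0 0 2 0 2 2 ∷
  certificate (F1 , F2 , F0) (F1 , F1 , F1) (F1 , F0 , F0) 0 1 0 2 1 0 0 1 ∷
  certificate (F1 , F2 , F0) (F2 , F1 , F1) (F1 , F0 , F1) 0 1 0 2 1 0 2 2 ∷
  certificate (F1 , F2 , F0) (F1 , F2 , F1) (F2 , F2 , F1) 0 2 0 0 2 0 2 2 ∷
  certificate (F1 , F2 , F0) (F1 , F2 , F1) (F2 , F2 , F1) 0 2 0 0 2 0 2 2 ∷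
  certificate (F1 , F2 , F2) (F2 , F2 , F1) (F1 , F2 , F0) 0 1 0 1 2 0 1 0 ∷
  certificate (F1 , F2 , F2) (F2 , F2 , F1) (F1 , F2 , F0) 0 1 0 1 2 0 1 0 ∷
  certificate (F0 , F1 , F0) (F2 , F2 , F1) (F1 , F2 , F0) 0 1 0 1 2 0 0 1 ∷
  certificate (F0 , F1 , F0) (F2 , F1 , F1) (F1 , F2 , F0) 0 0 0 1 0 0 0 1 ∷
  certificate (F1 , F2 , F1) (F2 , F2 , F1) (F1 , F2 , F2) 0 2 0 0 2 0 1 0 ∷
  certificate (F1 , F0 , F0) (F2 , F1 , F0) (F1 , F2 , F1) 0 1 0 0 0 0 0 1 ∷
  certificate (F1 , F2 , F1) (F1 , F2 , F2) (F2 , F2 , F1) 0 2 0 2 0 0 0 1 ∷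
  certificate (F1 , F2 , F1) (F2 , F2 , F1) (F1 , F2 , F2) 0 2 0 0 2 0 1 0 ∷
  certificate (F2 , F1 , F0) (F1 , F2 , F1) (F0 , F1 , F1) 0 1 0 1 2 0 2 2 ∷
  certificate (F1 , F2 , F2) (F1 , F0 , F2) (F2 , F1 , F2) 0 2 0 1 1 0 1 0 ∷
  certificate (F1 , F2 , F2) (F1 , F2 , F0) (F2 , F2 , F1) 0 2 0 1 1 0 1 0 ∷
  certificate (F2 , F1 , F2) (F0 , F1 , F2) (F1 , F2 , F2) 0 2 0 1 1 0 1 0 ∷
  certificate (F2 , F2 , F1) (F0 , F2 , F1) (F1 , F2 , F2) 0 2 0 1 1 0 0 1 ∷
  certificate (F2 , F1 , F0) (F2 , F0 , F1) (F1 , F0 , F0) 0 0 0 1 0 0 0 1 ∷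
  certificate (F2 , F0 , F1) (F2 , F1 , F1) (F2 , F1 , F2) 0 2 0 2 0 0 2 2 ∷
  certificate (F2 , F0 , F1) (F2 , F1 , F1) (F2 , F1 , F2) 0 2 0 2 0 0 2 2 ∷
  certificate (F2 , F0 , F1) (F2 , F1 , F0) (F1 , F0 , F0) 0 0 0 0 1 0 1 0 ∷
  certificate (F2 , F0 , F1) (F2 , F1 , F1) (F2 , F1 , F2) 0 2 0 2 0 0 2 2 ∷
  certificate (F2 , F2 , F1) (F2 , F1 , F2) (F2 , F0 , F1) 0 1 0 2 1 0 0 1 ∷
  certificate (F2 , F2 , F1) (F2 , F1 , F2) (F2 , F0 , F1) 0 1 0 2 1 0 0 1 ∷
  certificate (F2 , F1 , F0) (F2 , F1 , F1) (F2 , F2 , F1) 0 2 0 2 0 0 2 2 ∷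
  certificate (F2 , F1 , F0) (F2 , F1 , F1) (F2 , F2 , F1) 0 2 0 2 0 0 2 2 ∷
  certificate (F2 , F1 , F0) (F2 , F1 , F1) (F2 , F2 , F1) 0 2 0 2 0 0 2 2 ∷
  certificate (F2 , F1 , F2) (F2 , F2 , F1) (F2 , F1 , F0) 0 1 0 1 2 0 1 0 ∷
  certificate (F2 , F1 , F2) (F2 , F2 , F1) (F2 , F1 , F0) 0 1 0 1 2 0 1 0 ∷
  certificate (F2 , F1 , F1) (F2 , F2 , F1) (F2 , F1 , F2) 0 2 0 0 2 0 1 0 ∷
  certificate (F2 , F1 , F1) (F2 , F1 , F2) (F2 , F2 , F1) 0 2 0 0 2 0 1 0 ∷
  certificate (F2 , F1 , F1) (F2 , F2 , F1) (F2 , F1 , F2) 0 2 0 0 2 0 1 0 ∷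
  certificate (F2 , F1 , F2) (F2 , F1 , F0) (F2 , F2 , F1) 0 2 0 1 1 0 0 1 ∷
  certificate (F2 , F2 , F1) (F2 , F0 , F1) (F2 , F1 , F2) 0 2 0 1 1 0 0 1 ∷
  []

opaque
  unfolding leaves

  leaves-certified : T (all-certified leaves certificates)
  leaves-certified = _

  leaves-cover : ∀ R → length R ≡ 3 → ZeroSumFree (R ++ e1 ∷ e2 ∷ e3 ∷ []) →
    Σ[ M ∈ Seq ] M ∈ leaves × M ↭ R ++ e1 ∷ e2 ∷ e3 ∷ []
  leaves-cover R len zsf = extensions-cover (λ _ → true) 3 (e1 ∷ e2 ∷ e3 ∷ []) R len (All.universal _ R) zsf

leaf-condB : ∀ {M} → M ∈ leaves → CondB (completion M) × HeightTwo (completion M)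
leaf-condB {M} M∈ = uncurry (valid-sound (completion M)) (all-certified-sound leaves certificates leaves-certified M∈)

standard-bSequence-atom : ∀ a₁ a₂ a₃ a₄ a₅ b₁ b₂ b₃ →
  a₁ ≤ 2 × a₂ ≤ 2 × a₃ ≤ 2 × a₄ ≤ 2 × a₅ ≤ 2 × b₁ ≤ 2 × b₂ ≤ 2 × b₃ ≤ 2 →
  (a₁ + a₂ + a₃ + a₄ + a₅) % 3 ≡ 1 → (b₁ + b₂ + b₃) % 3 ≡ 1 →
  IsAtom (bSequence e1 e2 e3 a₁ a₂ a₃ a₄ a₅ b₁ b₂ b₃)
standard-bSequence-atom a₁ a₂ a₃ a₄ a₅ b₁ b₂ b₃ (l₁ , l₂ , l₃ , l₄ , l₅ , l₆ , l₇ , l₈) sa sb =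
  atom-test-sound a₁ a₂ a₃ a₄ a₅ b₁ b₂ b₃
    (all-digits-sound 8 atom-test standard-bSequences-are-atoms
      (a₁ ∷ a₂ ∷ a₃ ∷ a₄ ∷ a₅ ∷ b₁ ∷ b₂ ∷ b₃ ∷ []) (l₁ ∷ l₂ ∷ l₃ ∷ l₄ ∷ l₅ ∷ l₆ ∷ l₇ ∷ l₈ ∷ []))
    (Equivalence.from T-∧ (fromWitness {a? = _ ≟ 1} sa , fromWitness {a? = _ ≟ 1} sb))

-- (b) ⇒ (a): transport the standard atom along the coordinate map of the basis.
condB⇒atom : ∀ U → CondB U → IsAtom U × length U ≡ 7
condB⇒atom U (e₁ , e₂ , e₃ , basis , a₁ , a₂ , a₃ , a₄ , a₅ , b₁ , b₂ , b₃ , bounds , sa , sb , U↭) =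
  atom-↭ U↭ (subst IsAtom image atom) , ↭-length U↭
  where
  ψ = lin e₁ e₂ e₃
  cong₃ : ∀ {A : Set} (f : G → G → G → A) {x x′ y y′ z z′} → x ≡ x′ → y ≡ y′ → z ≡ z′ → f x y z ≡ f x′ y′ z′
  cong₃ f refl refl refl = refl
  atom : IsAtom (map ψ (bSequence e1 e2 e3 a₁ a₂ a₃ a₄ a₅ b₁ b₂ b₃))
  atom = atom-map (lin-additive e₁ e₂ e₃) (basis-kernel basis) _
           (standard-bSequence-atom a₁ a₂ a₃ a₄ a₅ b₁ b₂ b₃ bounds sa sb)
  image : map ψ (bSequence e1 e2 e3 a₁ a₂ a₃ a₄ a₅ b₁ b₂ b₃) ≡ bSequence e₁ e₂ e₃ a₁ a₂ a₃ a₄ a₅ b₁ b₂ b₃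
  image = trans (map-bSequence (lin-additive e₁ e₂ e₃) e1 e2 e3 a₁ a₂ a₃ a₄ a₅ b₁ b₂ b₃)
    (cong₃ (λ x y z → bSequence x y z a₁ a₂ a₃ a₄ a₅ b₁ b₂ b₃) (lin-e1 e₁ e₂ e₃) (lin-e2 e₁ e₂ e₃) (lin-e3 e₁ e₂ e₃))

NormalForm : Seq → ℕ → Set
NormalForm S k = Σ[ A ∈ Aut ] Σ[ R ∈ Seq ] (map (Aut.f A) S ↭ e1 ∷ e2 ∷ e3 ∷ R) × length R ≡ 3 + k

normalForm-pullback : ∀ (A : Aut) {S S′ k} → map (Aut.f A) S ↭ S′ → NormalForm S′ k → NormalForm S k
normalForm-pullback A {S} S↭ (B , R , S′↭ , len) =
  A then B , R , ↭-trans (↭-reflexive (map-∘ S)) (↭-trans (map⁺ (Aut.f B) S↭) S′↭) , len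

any-extract : ∀ {P : G → Set} {R} → Any P R → Σ[ y ∈ G ] Σ[ R′ ∈ Seq ] (R ↭ y ∷ R′) × P y
any-extract (here py) = _ , _ , ↭-refl , py
any-extract {R = x ∷ _} (there p) with any-extract p
... | y , R′ , R↭ , py = y , x ∷ R′ , ↭-trans (prep x R↭) (swap x y ↭-refl) , py

split-off : ∀ (ok : G → Bool) R → All (T ∘ ok) R ⊎ Σ[ y ∈ G ] Σ[ R′ ∈ Seq ] (R ↭ y ∷ R′) × ¬ T (ok y)
split-off ok R with All.all? (T? ∘ ok) R
... | yes all-ok = inj₁ all-ok
... | no ¬all-ok = inj₂ (any-extract (¬All⇒Any¬ (T? ∘ ok) R ¬all-ok))

image-↭ : ∀ (A : Aut) {R y R′ z} → R ↭ y ∷ R′ → Aut.f A y ≡ z → map (Aut.f A) R ↭ z ∷ map (Aut.f A) R′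
image-↭ A R↭ fy≡z = ↭-trans (map⁺ (Aut.f A) R↭) (↭-reflexive (cong (_∷ _) fy≡z))

length-image : ∀ (A : Aut) {R y R′} n → R ↭ y ∷ R′ → length R ≡ suc n → length (map (Aut.f A) R′) ≡ n
length-image A {R′ = R′} n R↭ len = trans (length-map (Aut.f A) R′) (ℕP.suc-injective (trans (sym (↭-length R↭)) len))

normal-form₃ : ∀ R k → ZeroSumFree (e1 ∷ e2 ∷ R) → length R ≡ 4 + k → NormalForm (e1 ∷ e2 ∷ R) k
normal-form₃ R k zsf len with split-off inPlane R
... | inj₁ in-plane = ⊥-elim (no-extension inPlane 4 (e1 ∷ e2 ∷ []) k R no-zsf-plane len in-plane zsf)
... | inj₂ (y , R′ , R↭ , y∉plane) =
  let A , e1↦ , e2↦ , y↦ = normalise₃ y y∉plane in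
  A , map (Aut.f A) R′ ,
  ↭-trans (prep (Aut.f A e1) (prep (Aut.f A e2) (image-↭ A R↭ y↦)))
          (↭-reflexive (cong₂ (λ a b → a ∷ b ∷ e3 ∷ map (Aut.f A) R′) e1↦ e2↦)) ,
  length-image A (3 + k) R↭ len

normal-form₂ : ∀ R k → ZeroSumFree (e1 ∷ R) → length R ≡ 5 + k → NormalForm (e1 ∷ R) k
normal-form₂ R k zsf len with split-off inLine R
... | inj₁ in-line = ⊥-elim (no-extension inLine 5 (e1 ∷ []) k R no-zsf-line len in-line zsf)
... | inj₂ (y , R′ , R↭ , y∉line) =
  let A , e1↦ , y↦ = normalise₂ y y∉line
      S↭ = ↭-trans (prep (Aut.f A e1) (image-↭ A R↭ y↦)) (↭-reflexive (cong (_∷ e2 ∷ map (Aut.f A) R′) e1↦))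
  in normalForm-pullback A S↭ (normal-form₃ (map (Aut.f A) R′) k
       (zsf-↭ S↭ (zsf-aut A (e1 ∷ R) zsf)) (length-image A (4 + k) R↭ len))

normal-form : ∀ S k → ZeroSumFree S → length S ≡ 6 + k → NormalForm S k
normal-form (s ∷ S) k zsf len =
  let A , s↦ = normalise₁ s (λ s≡0 → zsf [ s ] S ↭-refl (λ ()) (trans (⊕-identityʳ s) s≡0))
      S↭ = ↭-reflexive (cong (_∷ map (Aut.f A) S) s↦)
  in normalForm-pullback A S↭ (normal-form₂ (map (Aut.f A) S) k
       (zsf-↭ S↭ (zsf-aut A (s ∷ S) zsf))
       (trans (length-map (Aut.f A) S) (ℕP.suc-injective len)))

zsf-length≤6 : ∀ S → ZeroSumFree S → length S ≤ 6
zsf-length≤6 S zsf with length S ≤? 6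
... | yes ≤6 = ≤6
... | no ≰6 =
  let k , 7+k≡ = ℕP.m≤n⇒∃[o]m+o≡n (ℕP.≰⇒> ≰6)
      A , R , S↭ , lenR = normal-form S (suc k) zsf (sym 7+k≡)
  in ⊥-elim (no-extension (λ _ → true) 4 (e1 ∷ e2 ∷ e3 ∷ []) k R no-zsf-space lenR (All.universal _ R)
               (zsf-↭ S↭ (zsf-aut A S zsf)))

atom-length≤7 : ∀ U → IsAtom U → length U ≤ 7
atom-length≤7 [] atom = ⊥-elim (proj₁ atom refl)
atom-length≤7 (x ∷ S) atom = s≤s (zsf-length≤6 S (atom⇒zsf-tail x S atom))

image-completion : ∀ (A : Aut) x S {M} → σ (x ∷ S) ≡ 0G → map (Aut.f A) S ↭ M →
  map (Aut.f A) (x ∷ S) ↭ completion M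
image-completion A x S {M} σ≡0 S↭ = prep (f x) S↭ ⟨↭⟩ ↭-reflexive (cong (_∷ M) fx≡)
  where
  open Aut A
  _⟨↭⟩_ = ↭-trans
  fx≡ : f x ≡ 2 · σ M
  fx≡ = trans (⊕-inverse-unique (f x) (f (σ S))
                (trans (sym (⊕-homo f-additive x (σ S))) (trans (cong f σ≡0) (additive-zero f-additive))))
              (cong (2 ·_) (trans (sym (σ-map f-additive S)) (σ-↭ S↭)))

-- (a) ⇒ (b), with h = 2: normalise the tail, find it among the leaves, and transport back.
long-atom⇒condB : ∀ U → IsAtom U → length U ≡ 7 → CondB U × HeightTwo U
long-atom⇒condB (x ∷ S) atom len =
  let zsf = atom⇒zsf-tail x S atom
      A , R , S↭ , lenR = normal-form S 0 zsf (ℕP.suc-injective len)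
      R↭ = ↭-trans S↭ (++-comm (e1 ∷ e2 ∷ e3 ∷ []) R)
      M , M∈ , M↭ = leaves-cover R lenR (zsf-↭ R↭ (zsf-aut A S zsf))
      U↭ = image-completion A x S (proj₁ (proj₂ atom)) (↭-trans R↭ (↭-sym M↭))
      condB , height = leaf-condB M∈
  in condB-map A (x ∷ S) (condB-↭ U↭ condB) , heightTwo-map A (x ∷ S) (heightTwo-↭ U↭ height)

lemma5p7 : (d : ℕ) → IsDavenport d →
    (∀ (U : Seq) → (IsAtom U × length U ≡ d) ⇔ CondB U) ×
    (∀ (U : Seq) → IsAtom U → length U ≡ d → h U ≡ 2)
lemma5p7 d ((U₀ , atom₀ , len₀) , maximal) =
  (λ U → mk⇔ (λ (atom , len) → proj₁ (long-atom⇒condB U atom (trans len d≡7)))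
             (λ condB → let atom , len = condB⇒atom U condB in atom , trans len (sym d≡7))) ,
  (λ U atom len → heightTwo⇒h≡2 U (proj₂ (long-atom⇒condB U atom (trans len d≡7))))
  where
  -- D(G) = 7: every atom is that short, and (b) provides one of length 7
  d≡7 : d ≡ 7
  d≡7 = ℕP.≤-antisym (subst (_≤ 7) len₀ (atom-length≤7 U₀ atom₀))
          (maximal _ (standard-bSequence-atom 1 0 0 0 0 1 0 0 (s≤s z≤n , z≤n , z≤n , z≤n , z≤n , s≤s z≤n , z≤n , z≤n) refl refl))
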